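{- A graded basis $\{P_\alpha\}$ of $\mathrm{QSym}$ is a QPS basis if and only if the basis $\{P_\alpha'\}$ given by $P_\alpha' = \frac{1}{\mathrm{aut}(\alpha)} P_\alpha$ is a normalized shuffle basis.
   Context: Work over a field $\mathbbm{k}$ of characteristic zero. For a composition $\alpha$ (finite sequence of positive integers), $m_i(\alpha)$ is the number of parts equal to $i$, $\mathrm{aut}(\alpha)=\prod_i m_i(\alpha)!$, $\prod(\alpha)$ is the product of the parts, and $z_\alpha=\mathrm{aut}(\alpha)\prod(\alpha)$. For compositions $\alpha,\beta$, $\alpha \sqcup\!\sqcup \beta$ is the multiset of all compositions of length $\ell(\alpha)+\ell(\beta)$ containing $\alpha,\beta$ as disjoint subsequences, with multiplicity; $\alpha\sim\beta$ means $\alpha$ is a rearrangement of $\beta$. $\{M_\alpha\}$ is the monomial basis of $\mathrm{QSym}$ and $p_\lambda$ the symmetric power sums. A quasisymmetric power sum (QPS) basis is a graded basis $\{P_\alpha\}$ of $\mathrm{QSym}$ with (i) $P_\alpha P_\beta=\frac{z_\alpha z_\beta}{z_{\alpha\beta}}\sum_{\gamma\in\alpha \sqcup\!\sqcup \beta}P_\gamma$; (ii) $\Delta(P_\alpha)=\sum_{\beta\gamma=\alpha}\frac{z_\alpha}{z_\beta z_\gamma}P_\beta\otimes P_\gamma$; (iii) $\sum_{\alpha\sim\lambda}P_\alpha=p_\lambda$ for every partition $\lambda$. A shuffle basis is a graded basis $\{X_\alpha\}$ with $X_\alpha X_\beta=\sum_{\gamma\in\alpha \sqcup\!\sqcup \beta}X_\gamma$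 and $\Delta(X_\gamma)=\sum_{\alpha\beta=\gamma}X_\alpha\otimes X_\beta$; it is normalized if $X_n=M_n$ for all positive integers $n$. -}

module Defs where

open import Level using (Level; _⊔_) renaming (suc to lsuc)
open import Algebra.Bundles using (CommutativeRing)
open import Data.Nat as ℕ using (ℕ; zero; suc; _≥_)
open import Data.Nat.Base using (_!)
open import Data.List using (List; []; _∷_; [_]; _++_; map; concat; concatMap; foldr; length; filter; upTo)
open import Data.List.Properties using (≡-dec)
open import Data.Nat.ListAction using (sum; product)
open import Data.List.Relation.Unary.Linked using (Linked)
open import Data.List.Relation.Unary.Unique.Propositional using (Unique)
open import Data.List.Membership.Propositional using (_∈_)
open import Data.List.Relation.Binary.Permutation.Propositional using (_↭_)
open import Data.Product using (_×_; _,_; ∃)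
open import Data.Bool using (if_then_else_)
open import Function.Bundles using (_⇔_)
open import Relation.Nullary using (¬_; does)
open import Relation.Binary.PropositionalEquality using (_≡_)

record Field c ℓ : Set (lsuc (c ⊔ ℓ)) where
  field
    commutativeRing : CommutativeRing c ℓ
  open CommutativeRing commutativeRing public
  field
    _⁻¹        : Carrier → Carrier
    ⁻¹-inverse : ∀ x → ¬ (x ≈ 0#) → (x * (x ⁻¹)) ≈ 1#
    0≉1        : ¬ (0# ≈ 1#)

  fromℕ : ℕ → Carrier
  fromℕ zero    = 0#
  fromℕ (suc n) = 1# + fromℕ n

CharZero : ∀ {c ℓ} → Field c ℓ → Set ℓ
CharZero F = ∀ n → ¬ (fromℕ (suc n) ≈ 0#)
  where open Field F

-- Compositions.  ENCODING: a composition is a list of naturals where the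
-- entry p stands for the (positive) part  suc p.

Composition : Set
Composition = List ℕ

parts : Composition → List ℕ
parts α = map suc α

size : Composition → ℕ
size α = sum (parts α)

prodParts : Composition → ℕ
prodParts α = product (parts α)

-- m_i(α) for the part i = suc p
mult : ℕ → Composition → ℕ
mult p α = length (filter (ℕ._≟ p) α)

-- aut(α) = ∏_i m_i(α)!   (all parts of α are ≤ |α|)
aut : Composition → ℕ
aut α = product (map (λ p → mult p α !) (upTo (size α)))

z : Composition → ℕ
z α = aut α ℕ.* prodParts α

shuffle : Composition → Composition → List Composition
shuffle []       β        = [ β ]
shuffle (a ∷ α)  []       = [ a ∷ α ]
shuffle (a ∷ α)  (b ∷ β)  =
  map (a ∷_) (shuffle α (b ∷ β)) ++ map (b ∷_) (shuffle (a ∷ α) β)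

-- quasi-shuffle (stuffle) multiset: product of monomial quasisymmetric
-- functions.  Merging parts (suc a) and (suc b) gives part suc (suc (a ℕ.+ b)),
-- i.e. encoded entry suc (a ℕ.+ b).
qshuffle : Composition → Composition → List Composition
qshuffle []       β        = [ β ]
qshuffle (a ∷ α)  []       = [ a ∷ α ]
qshuffle (a ∷ α)  (b ∷ β)  =
  map (a ∷_) (qshuffle α (b ∷ β)) ++ map (b ∷_) (qshuffle (a ∷ α) β)
  ++ map (suc (a ℕ.+ b) ∷_) (qshuffle α β)

deconc : Composition → List (Composition × Composition)
deconc []      = [ ([] , []) ]
deconc (a ∷ γ) = ([] , a ∷ γ) ∷ map (λ { (x , y) → (a ∷ x , y) }) (deconc γ)

_≟c_ = ≡-dec ℕ._≟_

IsPartition : Composition → Set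
IsPartition λ′ = Linked _≥_ λ′

-- QSym over a field, as formal finite linear combinations of the
-- monomial basis M_α, with equality = equality of all coefficients.

module QSymOver {c ℓ} (F : Field c ℓ) where
  open Field F

  QSym : Set c
  QSym = List (Carrier × Composition)

  coeff : QSym → Composition → Carrier
  coeff f β = foldr (λ { (a , α) acc → (if does (α ≟c β) then a else 0#) + acc }) 0# f

  _≋_ : QSym → QSym → Set ℓ
  f ≋ g = ∀ β → coeff f β ≈ coeff g β

  scale : Carrier → QSym → QSym
  scale k f = map (λ { (a , α) → (k * a , α) }) f

  sumQ : List QSym → QSym
  sumQ = concat

  M : Composition → QSym
  M α = [ (1# , α) ]

  _⊛_ : QSym → QSym → QSym
  f ⊛ g = concatMap (λ { (a , α) → concatMap (λ { (b , β) →
            map (λ γ → (a * b , γ)) (qshuffle α β) }) g }) f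

  -- QSym ⊗ QSym, in the basis M_α ⊗ M_β
  QSym² : Set c
  QSym² = List (Carrier × Composition × Composition)

  coeff² : QSym² → Composition → Composition → Carrier
  coeff² t β γ = foldr (λ { (a , α , α′) acc →
      (if does (α ≟c β) then (if does (α′ ≟c γ) then a else 0#) else 0#) + acc }) 0# t

  _≋²_ : QSym² → QSym² → Set ℓ
  s ≋² t = ∀ β γ → coeff² s β γ ≈ coeff² t β γ

  scale² : Carrier → QSym² → QSym² 
  scale² k t = map (λ { (a , αα) → (k * a , αα) }) t

  _⊗_ : QSym → QSym → QSym²
  f ⊗ g = concatMap (λ { (a , α) → map (λ { (b , β) → (a * b , α , β) }) g }) f

  Δ : QSym → QSym²
  Δ f = concatMap (λ { (a , γ) → map (λ { (x , y) → (a , x , y) }) (deconc γ) }) f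

  p : Composition → QSym
  p λ′ = foldr (λ n acc → M [ n ] ⊛ acc) (M []) λ′

  _÷_ : ℕ → ℕ → Carrier
  k ÷ m = fromℕ k * (fromℕ m ⁻¹)

  lincomb : (Composition → QSym) → List Composition → (Composition → Carrier) → QSym
  lincomb P L k = sumQ (map (λ α → scale (k α) (P α)) L)

  record IsGradedBasis (P : Composition → QSym) : Set (c ⊔ ℓ) where
    field
      homogeneous : ∀ α β → ¬ (size β ≡ size α) → coeff (P α) β ≈ 0#
      independent : ∀ (L : List Composition) (k : Composition → Carrier) →
                    Unique L → lincomb P L k ≋ [] → ∀ α → α ∈ L → k α ≈ 0#
      spanning    : ∀ (f : QSym) →
                    ∃ λ (L : List Composition) → ∃ λ (k : Composition → Carrier) →
                      f ≋ lincomb P L k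

  record IsQPSBasis (P : Composition → QSym) : Set (c ⊔ ℓ) where
    field
      gradedBasis : IsGradedBasis P
      product-rule : ∀ α β →
        (P α ⊛ P β) ≋ scale ((z α ℕ.* z β) ÷ z (α ++ β)) (sumQ (map P (shuffle α β)))
      coproduct-rule : ∀ α →
        Δ (P α) ≋² concat (map (λ { (β , γ) →
            scale² (z α ÷ (z β ℕ.* z γ)) (P β ⊗ P γ) }) (deconc α))
      power-sum-rule : ∀ (λ′ : Composition) → IsPartition λ′ →
        ∀ (L : List Composition) → Unique L → (∀ α → (α ∈ L) ⇔ (α ↭ λ′)) →
        sumQ (map P L) ≋ p λ′

  record IsShuffleBasis (X : Composition → QSym) : Set (c ⊔ ℓ) where
    field
      gradedBasis : IsGradedBasis X
      product-rule : ∀ α β → (X α ⊛ X β) ≋ sumQ (map X (shuffle α β))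
      coproduct-rule : ∀ γ →
        Δ (X γ) ≋² concat (map (λ { (α , β) → X α ⊗ X β }) (deconc γ))

  record IsNormalizedShuffleBasis (X : Composition → QSym) : Set (c ⊔ ℓ) where
    field
      shuffleBasis : IsShuffleBasis X
      normalized   : ∀ n → X [ n ] ≋ M [ n ]

{-# OPTIONS --safe #-}
module Submission where

open import Defs

-- Put A_α = aut(α) ∈ 𝕜 and X_α = P_α / A_α. Every term of α ⧢ β is a rearrangement of αβ, and
-- aut is invariant under rearrangement; moreover z_α = aut(α) ∏(α) with ∏ multiplicative, so the
-- scalars in the QPS product and coproduct rules are A_α A_β / A_αβ and A_αβ / (A_α A_β). Hence these
-- rules for P are equivalent to the shuffle product and deconcatenation coproduct for X, and the
-- power-sum rule for λ = (n) gives X_(n) = P_(n) = p_n = M_(n), as aut((n)) = 1.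
-- Conversely, in a shuffle basis the constant coefficient c of X_∅ satisfies c = c² (coproduct) and
-- c ≠ 0 (independence), so X_∅ = M_∅. If moreover X_(n) = M_(n), then p_λ = X_(λ₁) ⋯ X_(λₖ) is the sum
-- of X_γ over the multiset (λ₁) ⧢ ⋯ ⧢ (λₖ), in which every rearrangement of λ occurs exactly aut(λ)
-- times: inserting n into δ yields γ as often as deleting an n from γ yields δ, and γ has m_n(γ) parts n.
-- Thus p_λ = aut(λ) Σ_{α∼λ} X_α = Σ_{α∼λ} P_α.

module Combinatorics where

  open import Data.Nat as ℕ using (ℕ; zero; suc; _+_; _*_; _≤_; _<_; NonZero)
  open import Data.Nat.Base using (_!)
  open import Data.Nat.Properties
    using (+-assoc; +-identityʳ; *-identityʳ; *-zeroʳ; *-assoc; *-comm; +-cancelˡ-≡;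
           ≤-trans; ≤-refl; <-irrefl; m≤n⇒m<n∨m≡n; m≤m+n; m≤n+m; n<1+n; m<n⇒m<1+n; <-cmp; _!≢0;
           +-commutativeSemigroup; *-commutativeSemigroup)
  import Algebra.Properties.CommutativeSemigroup as CommSemigroupProperties
  open import Data.Nat.ListAction using (sum; product)
  open import Data.Nat.ListAction.Properties using (sum-↭; product-++; product≢0)
  open import Data.List
    using (List; []; _∷_; [_]; _++_; map; concat; concatMap; length; upTo; applyUpTo; replicate)
  open import Data.List.Properties
    using (map-++; map-cong; map-upTo; applyUpTo-∷ʳ; length-map; filter-accept; filter-reject;
           ++-identityʳ; ∷-injective)
  open import Data.List.Membership.Propositional using (_∈_; _∉_)
  open import Data.List.Membership.Propositional.Properties using (∈-∃++; ∈-map⁻; ∈-++⁻)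
  open import Data.List.Relation.Unary.Any using (here; there)
  open import Data.List.Relation.Unary.All using (universal)
  open import Data.List.Relation.Unary.All.Properties using (map⁺)
  import Data.List.Relation.Unary.All as All
  open import Data.List.Relation.Unary.AllPairs using (_∷_)
  open import Data.List.Relation.Unary.Unique.Propositional using (Unique)
  open import Data.List.Relation.Binary.Permutation.Propositional
    using (_↭_; prep; swap; ↭-refl; ↭-sym; ↭-trans)
  open import Data.List.Relation.Binary.Permutation.Propositional.Properties
    using (↭-length; filter-↭; shift; drop-∷; ↭-empty-inv)
  import Data.List.Relation.Binary.Permutation.Propositional.Properties as ↭
  open import Data.Product using (_×_; _,_; proj₁; proj₂)
  open import Data.Sum using (inj₁; inj₂)
  open import Data.Bool using (if_then_else_)
  open import Function.Bundles using (_⇔_; Equivalence)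
  open import Data.Empty using (⊥-elim)
  open import Relation.Nullary using (¬_; Dec; does; yes; no)
  open import Relation.Nullary.Decidable using (dec-true; dec-false)
  open import Relation.Binary.Definitions using (DecidableEquality; tri<; tri≈; tri>)
  open import Relation.Binary.PropositionalEquality
    using (_≡_; _≢_; refl; sym; trans; cong; subst; module ≡-Reasoning)

  private
    module ℕ+ = CommSemigroupProperties +-commutativeSemigroup
    module ℕ* = CommSemigroupProperties *-commutativeSemigroup

  mult-↭ : ∀ p {α β} → α ↭ β → mult p α ≡ mult p β
  mult-↭ p π = ↭-length (filter-↭ (ℕ._≟ p) π)

  size-↭ : ∀ {α β} → α ↭ β → size α ≡ size β
  size-↭ π = sum-↭ (↭.map⁺ suc π)

  aut-↭ : ∀ {α β} → α ↭ β → aut α ≡ aut β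
  aut-↭ {α} {β} π rewrite size-↭ π =
    cong product (map-cong (λ p → cong _! (mult-↭ p π)) (upTo (size β)))

  ∈-shuffle⇒↭ : ∀ α β {γ} → γ ∈ shuffle α β → γ ↭ α ++ β
  ∈-shuffle⇒↭ []      β       (here refl) = ↭-refl
  ∈-shuffle⇒↭ (a ∷ α) []      (here refl) rewrite ++-identityʳ α = ↭-refl
  ∈-shuffle⇒↭ (a ∷ α) (b ∷ β) γ∈ with ∈-++⁻ (map (a ∷_) (shuffle α (b ∷ β))) γ∈
  ... | inj₁ γ∈ˡ with δ , δ∈ , refl ← ∈-map⁻ (a ∷_) γ∈ˡ = prep a (∈-shuffle⇒↭ α (b ∷ β) δ∈)
  ... | inj₂ γ∈ʳ with δ , δ∈ , refl ← ∈-map⁻ (b ∷_) γ∈ʳ =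
    ↭-trans (prep b (∈-shuffle⇒↭ (a ∷ α) β δ∈)) (↭-sym (shift b (a ∷ α) β))

  prodParts-++ : ∀ α β → prodParts (α ++ β) ≡ prodParts α * prodParts β
  prodParts-++ α β rewrite map-++ suc α β = product-++ (map suc α) (map suc β)

  z*z≡aut*aut*prodParts : ∀ α β → z α * z β ≡ (aut α * aut β) * prodParts (α ++ β)
  z*z≡aut*aut*prodParts α β = trans (ℕ*.interchange (aut α) (prodParts α) (aut β) (prodParts β))
                                     (cong ((aut α * aut β) *_) (sym (prodParts-++ α β)))

  ∈-deconc⇒++ : ∀ γ {α β} → (α , β) ∈ deconc γ → α ++ β ≡ γ
  ∈-deconc⇒++ []      (here refl) = refl
  ∈-deconc⇒++ (a ∷ γ) (here refl) = refl
  ∈-deconc⇒++ (a ∷ γ) (there αβ∈) with _ , αβ∈′ , refl ← ∈-map⁻ _ αβ∈ = cong (a ∷_) (∈-deconc⇒++ γ αβ∈′)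

  aut-nonZero : ∀ α → NonZero (aut α)
  aut-nonZero α = product≢0 (map⁺ (universal (λ p → mult p α !≢0) (upTo (size α))))

  prodParts-nonZero : ∀ α → NonZero (prodParts α)
  prodParts-nonZero α = product≢0 (map⁺ (universal (λ _ → _) α))

  ∏upTo : (ℕ → ℕ) → ℕ → ℕ
  ∏upTo f N = product (applyUpTo f N)

  ∏upTo-suc : ∀ f N → ∏upTo f (suc N) ≡ ∏upTo f N * f N
  ∏upTo-suc f N = begin
    product (applyUpTo f (suc N))        ≡⟨ cong product (sym (applyUpTo-∷ʳ f N)) ⟩
    product (applyUpTo f N ++ [ f N ])   ≡⟨ product-++ (applyUpTo f N) [ f N ] ⟩
    ∏upTo f N * (f N * 1)                ≡⟨ cong (∏upTo f N *_) (*-identityʳ (f N)) ⟩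
    ∏upTo f N * f N                      ∎
    where open ≡-Reasoning

  ∏upTo-cong : ∀ {f g} N → (∀ {p} → p < N → f p ≡ g p) → ∏upTo f N ≡ ∏upTo g N
  ∏upTo-cong zero    f≗g = refl
  ∏upTo-cong {f} {g} (suc N) f≗g rewrite ∏upTo-suc f N | ∏upTo-suc g N
    | ∏upTo-cong N (λ p<N → f≗g (m<n⇒m<1+n p<N)) | f≗g (n<1+n N) = refl

  ∏upTo-ones : ∀ {f N} N′ → N ≤ N′ → (∀ {p} → N ≤ p → f p ≡ 1) → ∏upTo f N′ ≡ ∏upTo f N
  ∏upTo-ones {f} N′ N≤N′ f≡1 with m≤n⇒m<n∨m≡n N≤N′
  ... | inj₂ refl = refl
  ... | inj₁ (ℕ.s≤s {n = N″} N≤N″) rewrite ∏upTo-suc f N″ | f≡1 N≤N″ | ∏upTo-ones N″ N≤N″ f≡1 =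
    *-identityʳ _

  ∏upTo-update : ∀ {f g n} k N → n < N → (∀ {p} → p ≢ n → f p ≡ g p) → f n ≡ k * g n →
                 ∏upTo f N ≡ k * ∏upTo g N
  ∏upTo-update {f} {g} {n} k (suc N) n<1+N f≗g fn rewrite ∏upTo-suc f N | ∏upTo-suc g N
    with <-cmp n N
  ... | tri< n<N _ _ rewrite ∏upTo-update k N n<N f≗g fn | f≗g {N} (λ N≡n → <-irrefl (sym N≡n) n<N) =
    *-assoc k (∏upTo g N) (g N)
  ... | tri≈ _ refl _ rewrite ∏upTo-cong {f} {g} n (λ p<n → f≗g (λ p≡n → <-irrefl p≡n p<n)) | fn = begin
    ∏upTo g n * (k * g n)  ≡⟨ sym (*-assoc (∏upTo g n) k (g n)) ⟩
    ∏upTo g n * k * g n    ≡⟨ cong (_* g n) (*-comm (∏upTo g n) k) ⟩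
    k * ∏upTo g n * g n    ≡⟨ *-assoc k (∏upTo g n) (g n) ⟩
    k * (∏upTo g n * g n)  ∎
    where open ≡-Reasoning
  ... | tri> _ _ N<n = ⊥-elim (<-irrefl refl (≤-trans n<1+N N<n))

  mult-∷-≡ : ∀ x {p} α → x ≡ p → mult p (x ∷ α) ≡ suc (mult p α)
  mult-∷-≡ x {p} α x≡p = cong length (filter-accept (ℕ._≟ p) x≡p)

  mult-∷-≢ : ∀ x {p} α → x ≢ p → mult p (x ∷ α) ≡ mult p α
  mult-∷-≢ x {p} α x≢p = cong length (filter-reject (ℕ._≟ p) x≢p)

  mult-≥size : ∀ α {p} → size α ≤ p → mult p α ≡ 0
  mult-≥size []      _      = refl
  mult-≥size (x ∷ α) α≤p =
    trans (mult-∷-≢ x α x≢p) (mult-≥size α (≤-trans (m≤n+m (size α) (suc x)) α≤p))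
    where
    x≢p : x ≢ _
    x≢p refl = <-irrefl refl (≤-trans (ℕ.s≤s (m≤m+n x (size α))) α≤p)

  aut≡∏upTo : ∀ α {N} → size α ≤ N → aut α ≡ ∏upTo (λ p → mult p α !) N
  aut≡∏upTo α {N} α≤N = trans (cong product (map-upTo _ (size α)))
    (sym (∏upTo-ones N α≤N (λ α≤p → cong _! (mult-≥size α α≤p))))

  aut-∷ : ∀ n α → aut (n ∷ α) ≡ suc (mult n α) * aut α
  aut-∷ n α = begin
    aut (n ∷ α)                                               ≡⟨ aut≡∏upTo (n ∷ α) ≤-refl ⟩
    ∏upTo (λ p → mult p (n ∷ α) !) (size (n ∷ α))             ≡⟨ ∏upTo-update {n = n} m+1 _ n<size other-parts part-n ⟩
    m+1 * ∏upTo (λ p → mult p α !) (size (n ∷ α))             ≡⟨ cong (m+1 *_) (aut≡∏upTo α (m≤n+m (size α) (suc n))) ⟨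
    m+1 * aut α                                               ∎
    where
    open ≡-Reasoning
    m+1 = suc (mult n α)
    n<size : n < size (n ∷ α)
    n<size = ℕ.s≤s (m≤m+n n (size α))
    other-parts : ∀ {p} → p ≢ n → mult p (n ∷ α) ! ≡ mult p α !
    other-parts p≢n = cong _! (mult-∷-≢ n α (λ n≡p → p≢n (sym n≡p)))
    part-n : mult n (n ∷ α) ! ≡ m+1 * mult n α !
    part-n = cong _! (mult-∷-≡ n α refl)

  sum-map-+ : ∀ {a} {A : Set a} (f g : A → ℕ) xs →
              sum (map (λ x → f x + g x) xs) ≡ sum (map f xs) + sum (map g xs)
  sum-map-+ f g []       = refl
  sum-map-+ f g (x ∷ xs) rewrite sum-map-+ f g xs = ℕ+.interchange (f x) (g x) _ _

  sum-map-const : ∀ {a} {A : Set a} (f : A → ℕ) k xs → (∀ {x} → x ∈ xs → f x ≡ k) →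
                  sum (map f xs) ≡ length xs * k
  sum-map-const f k []       _   = refl
  sum-map-const f k (x ∷ xs) f≡k rewrite f≡k (here refl) | sum-map-const f k xs (λ x∈ → f≡k (there x∈)) = refl

  module Multiplicity {a} {A : Set a} (_≟_ : DecidableEquality A) where

    open import Data.List.Membership.DecPropositional _≟_ using (_∈?_)

    indicator : A → A → ℕ
    indicator x y = if does (x ≟ y) then 1 else 0

    indicator-refl : ∀ x → indicator x x ≡ 1
    indicator-refl x = cong (λ b → if b then 1 else 0) (dec-true (x ≟ x) refl)

    indicator-≢ : ∀ {x y} → x ≢ y → indicator x y ≡ 0
    indicator-≢ {x} {y} x≢y = cong (λ b → if b then 1 else 0) (dec-false (x ≟ y) x≢y)

    indicator-sym : ∀ x y → indicator x y ≡ indicator y x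
    indicator-sym x y with x ≟ y
    ... | yes refl = sym (indicator-refl x)
    ... | no x≢y   = sym (indicator-≢ (λ y≡x → x≢y (sym y≡x)))

    count : A → List A → ℕ
    count x []       = 0
    count x (y ∷ ys) = indicator y x + count x ys

    count-++ : ∀ x xs ys → count x (xs ++ ys) ≡ count x xs + count x ys
    count-++ x []       ys = refl
    count-++ x (y ∷ xs) ys rewrite count-++ x xs ys = sym (+-assoc (indicator y x) (count x xs) (count x ys))

    count-∉ : ∀ {x} xs → x ∉ xs → count x xs ≡ 0
    count-∉ []       _   = refl
    count-∉ (y ∷ xs) x∉ rewrite count-∉ xs (λ x∈ → x∉ (there x∈)) =
      trans (+-identityʳ _) (indicator-≢ (λ y≡x → x∉ (here (sym y≡x))))

    count-unique : ∀ {x xs} → Unique xs → x ∈ xs → count x xs ≡ 1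
    count-unique {xs = y ∷ xs} (y∉xs ∷ _) (here refl)
      rewrite indicator-refl y | count-∉ xs (λ y∈ → All.lookup y∉xs y∈ refl) = refl
    count-unique {xs = y ∷ xs} (y∉xs ∷ u) (there x∈)
      rewrite indicator-≢ (All.lookup y∉xs x∈) = count-unique u x∈

    count-concat-replicate : ∀ x m xs → count x (concat (replicate m xs)) ≡ m * count x xs
    count-concat-replicate x zero    xs = refl
    count-concat-replicate x (suc m) xs
      rewrite count-++ x xs (concat (replicate m xs)) | count-concat-replicate x m xs = refl

    count-concatMap : ∀ x (f : A → List A) xs → count x (concatMap f xs) ≡ sum (map (λ y → count x (f y)) xs)
    count-concatMap x f []       = refl
    count-concatMap x f (y ∷ xs)
      rewrite count-++ x (f y) (concatMap f xs) | count-concatMap x f xs = refl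

    sum-count-swap : ∀ xs ys → sum (map (λ x → count x ys) xs) ≡ sum (map (λ y → count y xs) ys)
    sum-count-swap []       ys = sym (trans (sum-map-const _ 0 ys (λ _ → refl)) (*-zeroʳ (length ys)))
    sum-count-swap (x ∷ xs) ys rewrite sum-count-swap xs ys
      | sum-map-+ (λ y → indicator x y) (λ y → count y xs) ys = cong (_+ _) (count-as-sum ys)
      where
      count-as-sum : ∀ ys → count x ys ≡ sum (map (indicator x) ys)
      count-as-sum []       = refl
      count-as-sum (y ∷ ys) rewrite indicator-sym y x = cong (indicator x y +_) (count-as-sum ys)

    ≗count⇒↭ : ∀ xs ys → (∀ x → count x xs ≡ count x ys) → xs ↭ ys
    ≗count⇒↭ []       []       _      = ↭-refl
    ≗count⇒↭ []       (y ∷ ys) counts with () ← trans (counts y) (cong (_+ count y ys) (indicator-refl y))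
    ≗count⇒↭ (x ∷ xs) ys       counts with x ∈? ys
    ... | no x∉ys with () ← trans (sym (cong (_+ count x xs) (indicator-refl x))) (trans (counts x) (count-∉ ys x∉ys))
    ... | yes x∈ys with us , vs , refl ← ∈-∃++ x∈ys =
      ↭-trans (prep x (≗count⇒↭ xs (us ++ vs) counts′)) (↭-sym (shift x us vs))
      where
      counts′ : ∀ y → count y xs ≡ count y (us ++ vs)
      counts′ y = +-cancelˡ-≡ (indicator x y) _ _ (begin
        indicator x y + count y xs                   ≡⟨ counts y ⟩
        count y (us ++ x ∷ vs)                 ≡⟨ count-++ y us (x ∷ vs) ⟩
        count y us + (indicator x y + count y vs)    ≡⟨ ℕ+.x∙yz≈y∙xz (count y us) (indicator x y) (count y vs) ⟩
        indicator x y + (count y us + count y vs)    ≡⟨ cong (indicator x y +_) (sym (count-++ y us vs)) ⟩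
        indicator x y + count y (us ++ vs)           ∎)
        where open ≡-Reasoning

  open Multiplicity _≟c_
  open import Data.List.Membership.DecPropositional _≟c_ using (_∈?_)

  indicator-∷ : ∀ b δ γ → indicator (b ∷ δ) (b ∷ γ) ≡ indicator δ γ
  indicator-∷ b δ γ = by-cases (δ ≟c γ)
    where
    by-cases : Dec (δ ≡ γ) → indicator (b ∷ δ) (b ∷ γ) ≡ indicator δ γ
    by-cases (yes refl) = trans (indicator-refl (b ∷ δ)) (sym (indicator-refl δ))
    by-cases (no δ≢γ)   = trans (indicator-≢ {b ∷ δ} {b ∷ γ} (λ bδ≡bγ → δ≢γ (proj₂ (∷-injective bδ≡bγ))))
                                (sym (indicator-≢ {δ} {γ} δ≢γ))

  indicator-∷-≢ : ∀ {b g} δ γ → b ≢ g → indicator (b ∷ δ) (g ∷ γ) ≡ 0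
  indicator-∷-≢ {b} {g} δ γ b≢g = indicator-≢ {b ∷ δ} {g ∷ γ} (λ bδ≡gγ → b≢g (proj₁ (∷-injective bδ≡gγ)))

  count-[]-map-∷ : ∀ b L → count [] (map (b ∷_) L) ≡ 0
  count-[]-map-∷ b []      = refl
  count-[]-map-∷ b (δ ∷ L) = count-[]-map-∷ b L

  count-map-∷ : ∀ b γ L → count (b ∷ γ) (map (b ∷_) L) ≡ count γ L
  count-map-∷ b γ []      = refl
  count-map-∷ b γ (δ ∷ L) rewrite count-map-∷ b γ L | indicator-∷ b δ γ = refl

  count-map-∷-≢ : ∀ {b g} γ L → b ≢ g → count (g ∷ γ) (map (b ∷_) L) ≡ 0
  count-map-∷-≢ γ []      b≢g = refl
  count-map-∷-≢ γ (δ ∷ L) b≢g rewrite count-map-∷-≢ γ L b≢g | indicator-∷-≢ δ γ b≢g = refl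

  count-map-∷-swap : ∀ b g γ β A B → count γ A ≡ count β B →
                     count (g ∷ γ) (map (b ∷_) A) ≡ count (b ∷ β) (map (g ∷_) B)
  count-map-∷-swap b g γ β A B eq with b ℕ.≟ g
  ... | yes refl rewrite count-map-∷ b γ A | count-map-∷ b β B = eq
  ... | no b≢g   rewrite count-map-∷-≢ γ A b≢g | count-map-∷-≢ β B (λ g≡b → b≢g (sym g≡b)) = refl

  insertions : ℕ → Composition → List Composition
  insertions n δ = shuffle [ n ] δ

  deletions : ℕ → Composition → List Composition
  deletions n []      = []
  deletions n (g ∷ γ) with g ℕ.≟ n
  ... | yes _ = γ ∷ map (g ∷_) (deletions n γ)
  ... | no  _ = map (g ∷_) (deletions n γ)

  count-insertions : ∀ n δ γ → count γ (insertions n δ) ≡ count δ (deletions n γ)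
  count-insertions n []      []      = indicator-≢ {n ∷ []} {[]} (λ ())
  count-insertions n []      (g ∷ γ) with g ℕ.≟ n
  ... | yes refl rewrite count-[]-map-∷ g (deletions g γ) | indicator-∷ g [] γ | indicator-sym [] γ = refl
  ... | no g≢n   rewrite count-[]-map-∷ g (deletions n γ) | indicator-∷-≢ [] γ (λ n≡g → g≢n (sym n≡g)) = refl
  count-insertions n (b ∷ β) []      rewrite indicator-≢ {n ∷ b ∷ β} {[]} (λ ()) = count-[]-map-∷ b (insertions n β)
  count-insertions n (b ∷ β) (g ∷ γ) with g ℕ.≟ n
  ... | yes refl rewrite indicator-∷ g (b ∷ β) γ | indicator-sym (b ∷ β) γ =
    cong (indicator γ (b ∷ β) +_) (count-map-∷-swap b g γ β (insertions g β) (deletions g γ) (count-insertions g β γ))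
  ... | no g≢n   rewrite indicator-∷-≢ (b ∷ β) γ (λ n≡g → g≢n (sym n≡g)) =
    count-map-∷-swap b g γ β (insertions n β) (deletions n γ) (count-insertions n β γ)

  ∈-deletions⇒↭ : ∀ n γ {δ} → δ ∈ deletions n γ → γ ↭ n ∷ δ
  ∈-deletions⇒↭ n (g ∷ γ) δ∈ with g ℕ.≟ n
  ... | yes refl with δ∈
  ...   | here refl = ↭-refl
  ...   | there δ∈′ with δ′ , δ′∈ , refl ← ∈-map⁻ (g ∷_) δ∈′ =
    ↭-trans (prep g (∈-deletions⇒↭ n γ δ′∈)) (swap g n ↭-refl)
  ∈-deletions⇒↭ n (g ∷ γ) δ∈ | no _ with δ′ , δ′∈ , refl ← ∈-map⁻ (g ∷_) δ∈ =
    ↭-trans (prep g (∈-deletions⇒↭ n γ δ′∈)) (swap g n ↭-refl)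

  length-deletions : ∀ n γ → length (deletions n γ) ≡ mult n γ
  length-deletions n []      = refl
  length-deletions n (g ∷ γ) with g ℕ.≟ n
  ... | yes g≡n = trans (cong suc (trans (length-map (g ∷_) (deletions n γ)) (length-deletions n γ)))
                        (sym (mult-∷-≡ g γ g≡n))
  ... | no g≢n  = trans (trans (length-map (g ∷_) (deletions n γ)) (length-deletions n γ))
                        (sym (mult-∷-≢ g γ g≢n))

  shuffleSingletons : Composition → List Composition
  shuffleSingletons []      = [ [] ]
  shuffleSingletons (n ∷ λ′) = concatMap (insertions n) (shuffleSingletons λ′)

  count-shuffleSingletons : ∀ λ′ γ → (γ ↭ λ′ → count γ (shuffleSingletons λ′) ≡ aut λ′)
                                   × (¬ (γ ↭ λ′) → count γ (shuffleSingletons λ′) ≡ 0)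
  count-shuffleSingletons []       γ = (λ γ↭[] → cong (λ δ → count δ [ [] ]) (↭-empty-inv γ↭[]))
                                     , (λ γ≁[] → cong (_+ 0) (indicator-≢ (λ []≡γ → γ≁[] (subst (_↭ []) []≡γ ↭-refl))))
  count-shuffleSingletons (n ∷ λ′) γ = count-↭ , count-≁
    where
    S = shuffleSingletons λ′
    D = deletions n γ

    by-deletions : count γ (shuffleSingletons (n ∷ λ′)) ≡ sum (map (λ δ → count δ S) D)
    by-deletions = begin
      count γ (concatMap (insertions n) S)            ≡⟨ count-concatMap γ (insertions n) S ⟩
      sum (map (λ δ → count γ (insertions n δ)) S)    ≡⟨ cong sum (map-cong (λ δ → count-insertions n δ γ) S) ⟩
      sum (map (λ δ → count δ D) S)                   ≡⟨ sum-count-swap S D ⟩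
      sum (map (λ δ → count δ S) D)                   ∎
      where open ≡-Reasoning

    count-↭ : γ ↭ n ∷ λ′ → count γ (shuffleSingletons (n ∷ λ′)) ≡ aut (n ∷ λ′)
    count-↭ γ↭ = begin
      count γ (shuffleSingletons (n ∷ λ′))  ≡⟨ by-deletions ⟩
      sum (map (λ δ → count δ S) D)         ≡⟨ sum-map-const _ (aut λ′) D (λ δ∈ →
                                                 proj₁ (count-shuffleSingletons λ′ _)
                                                   (drop-∷ (↭-trans (↭-sym (∈-deletions⇒↭ n γ δ∈)) γ↭))) ⟩
      length D * aut λ′                     ≡⟨ cong (_* aut λ′) (trans (length-deletions n γ)
                                                 (trans (mult-↭ n γ↭) (mult-∷-≡ n λ′ refl))) ⟩
      suc (mult n λ′) * aut λ′              ≡⟨ sym (aut-∷ n λ′) ⟩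
      aut (n ∷ λ′)                          ∎
      where open ≡-Reasoning

    count-≁ : ¬ (γ ↭ n ∷ λ′) → count γ (shuffleSingletons (n ∷ λ′)) ≡ 0
    count-≁ γ≁ = begin
      count γ (shuffleSingletons (n ∷ λ′))  ≡⟨ by-deletions ⟩
      sum (map (λ δ → count δ S) D)         ≡⟨ sum-map-const _ 0 D (λ δ∈ →
                                                 proj₂ (count-shuffleSingletons λ′ _)
                                                   (λ δ↭ → γ≁ (↭-trans (∈-deletions⇒↭ n γ δ∈) (prep n δ↭)))) ⟩
      length D * 0                          ≡⟨ *-zeroʳ (length D) ⟩
      0                                     ∎
      where open ≡-Reasoning

  shuffleSingletons-↭ : ∀ λ′ {L} → Unique L → (∀ α → (α ∈ L) ⇔ (α ↭ λ′)) →
                        shuffleSingletons λ′ ↭ concat (replicate (aut λ′) L)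
  shuffleSingletons-↭ λ′ {L} unique L≡rearrangements = ≗count⇒↭ _ _ counts
    where
    counts : ∀ γ → count γ (shuffleSingletons λ′) ≡ count γ (concat (replicate (aut λ′) L))
    counts γ rewrite count-concat-replicate γ (aut λ′) L with γ ∈? L
    ... | yes γ∈L rewrite count-unique unique γ∈L =
      trans (proj₁ (count-shuffleSingletons λ′ γ) (Equivalence.to (L≡rearrangements γ) γ∈L))
            (sym (*-identityʳ (aut λ′)))
    ... | no γ∉L  rewrite count-∉ L γ∉L =
      trans (proj₂ (count-shuffleSingletons λ′ γ) (λ γ↭ → γ∉L (Equivalence.from (L≡rearrangements γ) γ↭)))
            (sym (*-zeroʳ (aut λ′)))

open Combinatorics

open import Level using (_⊔_)
open import Data.Nat as ℕ using (zero; suc; NonZero)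
import Data.Nat.Properties as ℕP
open import Data.List using (List; []; _∷_; [_]; _++_; map; concat; concatMap; length; replicate)
open import Data.List.Properties
  using (map-++; map-∘; map-cong-local; concat-map; concat-++; ++-identityʳ; ++-assoc)
open import Data.List.Membership.Propositional using (_∈_)
open import Data.List.Relation.Unary.Any using (here; there)
open import Data.List.Relation.Unary.All as All using ([])
open import Data.List.Relation.Unary.AllPairs using ([]; _∷_)
open import Data.List.Relation.Unary.Linked using ([-])
open import Data.List.Relation.Unary.Unique.Propositional using (Unique)
open import Data.List.Relation.Binary.Pointwise as Pointwise using (Pointwise; []; _∷_)
open import Data.List.Relation.Binary.Permutation.Propositional as ↭ using (_↭_; ↭-refl)
open import Data.List.Relation.Binary.Permutation.Propositional.Properties using (↭-singleton-inv)
open import Data.Product using (_×_; _,_)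
open import Data.Bool using (true; false; if_then_else_)
open import Data.Empty using (⊥-elim)
open import Function using (_∘_)
open import Function.Bundles using (_⇔_; mk⇔; Equivalence)
open import Relation.Nullary using (¬_; Dec; does; yes; no)
open import Relation.Nullary.Decidable using (dec-false)
open import Relation.Binary.Bundles using (Setoid)
open import Relation.Binary.PropositionalEquality as ≡ using (_≡_; _≢_)
import Relation.Binary.Reasoning.Setoid as SetoidReasoning
import Algebra.Properties.Ring as RingProperties
import Algebra.Properties.CommutativeSemigroup as CommSemigroupProperties

module FieldLemmas {c ℓ} (F : Field c ℓ) where
  open Field F
  open QSymOver F using (_÷_)
  private module *CS = CommSemigroupProperties *-commutativeSemigroup
  open SetoidReasoning setoid

  ⁻¹-inverseˡ : ∀ {x} → ¬ (x ≈ 0#) → x ⁻¹ * x ≈ 1#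
  ⁻¹-inverseˡ {x} x≉0 = trans (*-comm (x ⁻¹) x) (⁻¹-inverse x x≉0)

  ⁻¹-cancelˡ : ∀ {x} → ¬ (x ≈ 0#) → ∀ y → x ⁻¹ * (x * y) ≈ y
  ⁻¹-cancelˡ {x} x≉0 y = begin
    x ⁻¹ * (x * y)  ≈⟨ *-assoc (x ⁻¹) x y ⟨
    x ⁻¹ * x * y    ≈⟨ *-congʳ (⁻¹-inverseˡ x≉0) ⟩
    1# * y          ≈⟨ *-identityˡ y ⟩
    y               ∎

  ⁻¹-unique : ∀ {x y} → ¬ (x ≈ 0#) → x * y ≈ 1# → y ≈ x ⁻¹
  ⁻¹-unique {x} {y} x≉0 xy≈1 = begin
    y               ≈⟨ ⁻¹-cancelˡ x≉0 y ⟨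
    x ⁻¹ * (x * y)  ≈⟨ *-congˡ xy≈1 ⟩
    x ⁻¹ * 1#       ≈⟨ *-identityʳ (x ⁻¹) ⟩
    x ⁻¹            ∎

  *-≉0 : ∀ {x y} → ¬ (x ≈ 0#) → ¬ (y ≈ 0#) → ¬ (x * y ≈ 0#)
  *-≉0 {x} {y} x≉0 y≉0 xy≈0 = y≉0 (begin
    y               ≈⟨ ⁻¹-cancelˡ x≉0 y ⟨
    x ⁻¹ * (x * y)  ≈⟨ *-congˡ xy≈0 ⟩
    x ⁻¹ * 0#       ≈⟨ zeroʳ (x ⁻¹) ⟩
    0#              ∎)

  ⁻¹-≉0 : ∀ {x} → ¬ (x ≈ 0#) → ¬ (x ⁻¹ ≈ 0#)
  ⁻¹-≉0 {x} x≉0 x⁻¹≈0 = 0≉1 (begin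
    0#          ≈⟨ zeroʳ x ⟨
    x * 0#      ≈⟨ *-congˡ x⁻¹≈0 ⟨
    x * x ⁻¹    ≈⟨ ⁻¹-inverse x x≉0 ⟩
    1#          ∎)

  ⁻¹-cong : ∀ {x y} → ¬ (x ≈ 0#) → x ≈ y → x ⁻¹ ≈ y ⁻¹
  ⁻¹-cong {x} {y} x≉0 x≈y =
    ⁻¹-unique (λ y≈0 → x≉0 (trans x≈y y≈0)) (trans (*-congʳ (sym x≈y)) (⁻¹-inverse x x≉0))

  ⁻¹-distrib-* : ∀ {x y} → ¬ (x ≈ 0#) → ¬ (y ≈ 0#) → (x * y) ⁻¹ ≈ x ⁻¹ * y ⁻¹
  ⁻¹-distrib-* {x} {y} x≉0 y≉0 = sym (⁻¹-unique (*-≉0 x≉0 y≉0) (begin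
    x * y * (x ⁻¹ * y ⁻¹)    ≈⟨ *-assoc x y (x ⁻¹ * y ⁻¹) ⟩
    x * (y * (x ⁻¹ * y ⁻¹))  ≈⟨ *-congˡ (*-congˡ (*-comm (x ⁻¹) (y ⁻¹))) ⟩
    x * (y * (y ⁻¹ * x ⁻¹))  ≈⟨ *-congˡ (*-assoc y (y ⁻¹) (x ⁻¹)) ⟨
    x * (y * y ⁻¹ * x ⁻¹)    ≈⟨ *-congˡ (*-congʳ (⁻¹-inverse y y≉0)) ⟩
    x * (1# * x ⁻¹)          ≈⟨ *-congˡ (*-identityˡ (x ⁻¹)) ⟩
    x * x ⁻¹                 ≈⟨ ⁻¹-inverse x x≉0 ⟩
    1#                       ∎))

  fromℕ-+ : ∀ m n → fromℕ (m ℕ.+ n) ≈ fromℕ m + fromℕ n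
  fromℕ-+ zero    n = sym (+-identityˡ (fromℕ n))
  fromℕ-+ (suc m) n = trans (+-congˡ (fromℕ-+ m n)) (sym (+-assoc 1# (fromℕ m) (fromℕ n)))

  fromℕ-* : ∀ m n → fromℕ (m ℕ.* n) ≈ fromℕ m * fromℕ n
  fromℕ-* zero    n = sym (zeroˡ (fromℕ n))
  fromℕ-* (suc m) n = begin
    fromℕ (n ℕ.+ m ℕ.* n)               ≈⟨ fromℕ-+ n (m ℕ.* n) ⟩
    fromℕ n + fromℕ (m ℕ.* n)           ≈⟨ +-cong (sym (*-identityˡ (fromℕ n))) (fromℕ-* m n) ⟩
    1# * fromℕ n + fromℕ m * fromℕ n    ≈⟨ distribʳ (fromℕ n) 1# (fromℕ m) ⟨
    (1# + fromℕ m) * fromℕ n            ∎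

  fromℕ-≉0 : CharZero F → ∀ n → .{{NonZero n}} → ¬ (fromℕ n ≈ 0#)
  fromℕ-≉0 char0 (suc n) = char0 n

  x*y≈0⇒x≈0 : ∀ {x y} → ¬ (y ≈ 0#) → x * y ≈ 0# → x ≈ 0#
  x*y≈0⇒x≈0 {x} {y} y≉0 xy≈0 = begin
    x                 ≈⟨ ⁻¹-cancelˡ y≉0 x ⟨
    y ⁻¹ * (y * x)    ≈⟨ *-congˡ (trans (*-comm y x) xy≈0) ⟩
    y ⁻¹ * 0#         ≈⟨ zeroʳ _ ⟩
    0#                ∎

  ⁻¹*⁻¹-cancelˡ : ∀ {x y} → ¬ (x ≈ 0#) → ¬ (y ≈ 0#) → ∀ w → x ⁻¹ * y ⁻¹ * (x * y * w) ≈ w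
  ⁻¹*⁻¹-cancelˡ x≉0 y≉0 w =
    trans (*-congʳ (sym (⁻¹-distrib-* x≉0 y≉0))) (⁻¹-cancelˡ (*-≉0 x≉0 y≉0) w)

  ÷-cancelʳ : ∀ k m q → ¬ (fromℕ m ≈ 0#) → ¬ (fromℕ q ≈ 0#) → (k ℕ.* q) ÷ (m ℕ.* q) ≈ k ÷ m
  ÷-cancelʳ k m q m≉0 q≉0 = begin
    fromℕ (k ℕ.* q) * fromℕ (m ℕ.* q) ⁻¹        ≈⟨ *-cong (fromℕ-* k q) (⁻¹-cong mq≉0 (fromℕ-* m q)) ⟩
    fromℕ k * fromℕ q * (fromℕ m * fromℕ q) ⁻¹  ≈⟨ *-congˡ (⁻¹-distrib-* m≉0 q≉0) ⟩
    fromℕ k * fromℕ q * (fromℕ m ⁻¹ * fromℕ q ⁻¹) ≈⟨ *CS.interchange _ _ _ _ ⟩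
    fromℕ k * fromℕ m ⁻¹ * (fromℕ q * fromℕ q ⁻¹) ≈⟨ *-congˡ (⁻¹-inverse _ q≉0) ⟩
    fromℕ k * fromℕ m ⁻¹ * 1#                     ≈⟨ *-identityʳ _ ⟩
    fromℕ k * fromℕ m ⁻¹                          ∎
    where
    mq≉0 : ¬ (fromℕ (m ℕ.* q) ≈ 0#)
    mq≉0 mq≈0 = *-≉0 m≉0 q≉0 (trans (sym (fromℕ-* m q)) mq≈0)

module FormalSums {c ℓ} (F : Field c ℓ) where
  open Field F
  open QSymOver F
  open import Relation.Binary.Reasoning.MultiSetoid
  private
    module +CS = CommSemigroupProperties +-commutativeSemigroup
    module *CS = CommSemigroupProperties *-commutativeSemigroup
    module R = RingProperties ring

  _≈ᵗ_ : ∀ {I : Set} → Carrier × I → Carrier × I → Set ℓ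
  (a , i) ≈ᵗ (b , j) = a ≈ b × i ≡ j

  infix 4 _≐_
  _≐_ : ∀ {I : Set} → List (Carrier × I) → List (Carrier × I) → Set (c ⊔ ℓ)
  _≐_ = Pointwise _≈ᵗ_

  ≐-sym : ∀ {I : Set} {f g : List (Carrier × I)} → f ≐ g → g ≐ f
  ≐-sym = Pointwise.symmetric (λ (a≈b , i≡j) → sym a≈b , ≡.sym i≡j)

  ≐-trans : ∀ {I : Set} {f g h : List (Carrier × I)} → f ≐ g → g ≐ h → f ≐ h
  ≐-trans = Pointwise.transitive (λ (a≈b , i≡j) (b≈c , j≡k) → trans a≈b b≈c , ≡.trans i≡j j≡k)

  coeff-++ : ∀ f g β → coeff (f ++ g) β ≈ coeff f β + coeff g β
  coeff-++ []            g β = sym (+-identityˡ (coeff g β))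
  coeff-++ ((a , α) ∷ f) g β =
    trans (+-congˡ (coeff-++ f g β)) (sym (+-assoc _ (coeff f β) (coeff g β)))

  coeff-scale : ∀ k f β → coeff (scale k f) β ≈ k * coeff f β
  coeff-scale k []            β = sym (zeroʳ k)
  coeff-scale k ((a , α) ∷ f) β with does (α ≟c β)
  ... | true  = trans (+-congˡ (coeff-scale k f β)) (sym (distribˡ k a (coeff f β)))
  ... | false = trans (+-cong (sym (zeroʳ k)) (coeff-scale k f β)) (sym (distribˡ k 0# (coeff f β)))

  ≐⇒≋ : ∀ {f g} → f ≐ g → f ≋ g
  ≐⇒≋ []                                β = refl
  ≐⇒≋ (_∷_ {x = a , α} (a≈b , ≡.refl) f≐g) β with does (α ≟c β)
  ... | true  = +-cong a≈b (≐⇒≋ f≐g β)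
  ... | false = +-congˡ (≐⇒≋ f≐g β)

  -- _≋_ unfolds to a Π-type over coefficients, from which Agda cannot infer its arguments.
  infix 4 _≅_
  record _≅_ (f g : QSym) : Set ℓ where
    constructor mk≅
    field coeff≈ : f ≋ g
  open _≅_ public

  ≅-setoid : Setoid c ℓ
  ≅-setoid = record
    { Carrier       = QSym
    ; _≈_           = _≅_
    ; isEquivalence = record
      { refl  = mk≅ (λ β → refl)
      ; sym   = λ f≅g → mk≅ (λ β → sym (coeff≈ f≅g β))
      ; trans = λ f≅g g≅h → mk≅ (λ β → trans (coeff≈ f≅g β) (coeff≈ g≅h β))
      }
    }

  open Setoid ≅-setoid public
    using () renaming (refl to ≅-refl; sym to ≅-sym; trans to ≅-trans; reflexive to ≅-reflexive)

  ≐⇒≅ : ∀ {f g} → f ≐ g → f ≅ g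
  ≐⇒≅ f≐g = mk≅ (≐⇒≋ f≐g)

  ++-cong : ∀ {f f′ g g′} → f ≅ f′ → g ≅ g′ → (f ++ g) ≅ (f′ ++ g′)
  ++-cong {f} {f′} {g} {g′} f≅f′ g≅g′ = mk≅ λ β →
    trans (coeff-++ f g β) (trans (+-cong (coeff≈ f≅f′ β) (coeff≈ g≅g′ β)) (sym (coeff-++ f′ g′ β)))

  ++-comm-≅ : ∀ f g → (f ++ g) ≅ (g ++ f)
  ++-comm-≅ f g = mk≅ λ β → trans (coeff-++ f g β) (trans (+-comm _ _) (sym (coeff-++ g f β)))

  scale-cong : ∀ {k k′ f f′} → k ≈ k′ → f ≅ f′ → scale k f ≅ scale k′ f′
  scale-cong {k} {k′} {f} {f′} k≈k′ f≅f′ = mk≅ λ β →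
    trans (coeff-scale k f β) (trans (*-cong k≈k′ (coeff≈ f≅f′ β)) (sym (coeff-scale k′ f′ β)))

  scale-scale : ∀ {k k′ k″} → k * k′ ≈ k″ → ∀ f → scale k (scale k′ f) ≐ scale k″ f
  scale-scale kk′≈k″ []            = []
  scale-scale kk′≈k″ ((a , α) ∷ f) =
    (trans (sym (*-assoc _ _ a)) (*-congʳ kk′≈k″) , ≡.refl) ∷ scale-scale kk′≈k″ f

  scale-congᵗ : ∀ {k k′} → k ≈ k′ → ∀ f → scale k f ≐ scale k′ f
  scale-congᵗ k≈k′ []            = []
  scale-congᵗ k≈k′ ((a , α) ∷ f) = (*-congʳ k≈k′ , ≡.refl) ∷ scale-congᵗ k≈k′ f

  scale-1 : ∀ f → scale 1# f ≐ f
  scale-1 []            = []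
  scale-1 ((a , α) ∷ f) = (*-identityˡ a , ≡.refl) ∷ scale-1 f

  scale-concat : ∀ {X : Set} k (G : X → QSym) xs → scale k (concat (map G xs)) ≡ concat (map (scale k ∘ G) xs)
  scale-concat k G xs = ≡.trans (≡.sym (concat-map (map G xs))) (≡.cong concat (≡.sym (map-∘ xs)))

  concat-map-cong : ∀ {X : Set} {G H : X → QSym} xs → (∀ {x} → x ∈ xs → G x ≅ H x) →
                    concat (map G xs) ≅ concat (map H xs)
  concat-map-cong []       G≅H = ≅-refl
  concat-map-cong (x ∷ xs) G≅H = ++-cong (G≅H (here ≡.refl)) (concat-map-cong xs (G≅H ∘ there))

  if-does-≢ : ∀ {γ β} a → γ ≢ β → (if does (γ ≟c β) then a else 0#) ≈ 0#
  if-does-≢ {γ} {β} a γ≢β rewrite dec-false (γ ≟c β) γ≢β = refl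

  linear : (Composition → Carrier) → QSym → Carrier
  linear H []            = 0#
  linear H ((a , α) ∷ f) = a * H α + linear H f

  linear-++ : ∀ H f g → linear H (f ++ g) ≈ linear H f + linear H g
  linear-++ H []            g = sym (+-identityˡ _)
  linear-++ H ((a , α) ∷ f) g = trans (+-congˡ (linear-++ H f g)) (sym (+-assoc _ _ _))

  linear-scale : ∀ H k f → linear H (scale k f) ≈ k * linear H f
  linear-scale H k []            = sym (zeroʳ k)
  linear-scale H k ((a , α) ∷ f) =
    trans (+-cong (*-assoc k a (H α)) (linear-scale H k f)) (sym (distribˡ k _ _))

  linear-congˡ : ∀ {H H′} f → (∀ α → H α ≈ H′ α) → linear H f ≈ linear H′ f
  linear-congˡ []            H≈H′ = refl
  linear-congˡ ((a , α) ∷ f) H≈H′ = +-cong (*-congˡ (H≈H′ α)) (linear-congˡ f H≈H′)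

  linear-+ : ∀ H H′ f → linear (λ α → H α + H′ α) f ≈ linear H f + linear H′ f
  linear-+ H H′ []            = sym (+-identityˡ 0#)
  linear-+ H H′ ((a , α) ∷ f) =
    trans (+-cong (distribˡ a (H α) (H′ α)) (linear-+ H H′ f)) (+CS.interchange _ _ _ _)

  without : Composition → QSym → QSym
  without α []            = []
  without α ((a , γ) ∷ f) with γ ≟c α
  ... | yes _ = without α f
  ... | no  _ = (a , γ) ∷ without α f

  linear-without : ∀ H α f → linear H f ≈ coeff f α * H α + linear H (without α f)
  linear-without H α []            = sym (trans (+-identityʳ _) (zeroˡ (H α)))
  linear-without H α ((a , γ) ∷ f) with γ ≟c α
  ... | yes ≡.refl = begin⟨ setoid ⟩
    a * H γ + linear H f                              ≈⟨ +-congˡ (linear-without H γ f) ⟩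
    a * H γ + (coeff f γ * H γ + linear H (without γ f))  ≈⟨ +-assoc _ _ _ ⟨
    a * H γ + coeff f γ * H γ + linear H (without γ f)    ≈⟨ +-congʳ (distribʳ (H γ) a (coeff f γ)) ⟨
    (a + coeff f γ) * H γ + linear H (without γ f)        ∎
  ... | no γ≢α = begin⟨ setoid ⟩
    a * H γ + linear H f                                     ≈⟨ +-congˡ (linear-without H α f) ⟩
    a * H γ + (coeff f α * H α + linear H (without α f))     ≈⟨ +CS.x∙yz≈y∙xz _ _ _ ⟩
    coeff f α * H α + (a * H γ + linear H (without α f))     ≈⟨ +-congʳ (*-congʳ (+-identityˡ _)) ⟨
    (0# + coeff f α) * H α + (a * H γ + linear H (without α f)) ∎

  coeff-without-≡ : ∀ α f → coeff (without α f) α ≈ 0#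
  coeff-without-≡ α []            = refl
  coeff-without-≡ α ((a , γ) ∷ f) with γ ≟c α
  ... | yes _   = coeff-without-≡ α f
  ... | no γ≢α  = trans (+-cong (if-does-≢ a γ≢α) (coeff-without-≡ α f)) (+-identityˡ 0#)

  coeff-without-≢ : ∀ α f {β} → β ≢ α → coeff (without α f) β ≈ coeff f β
  coeff-without-≢ α []            β≢α = refl
  coeff-without-≢ α ((a , γ) ∷ f) β≢α with γ ≟c α
  ... | yes ≡.refl = trans (coeff-without-≢ α f β≢α)
                       (trans (sym (+-identityˡ _)) (+-congʳ (sym (if-does-≢ a (λ α≡β → β≢α (≡.sym α≡β))))))
  ... | no _       = +-congˡ (coeff-without-≢ α f β≢α)

  length-without : ∀ α f → length (without α f) ℕ.≤ length f
  length-without α []            = ℕ.z≤n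
  length-without α ((a , γ) ∷ f) with γ ≟c α
  ... | yes _ = ℕP.m≤n⇒m≤1+n (length-without α f)
  ... | no _  = ℕ.s≤s (length-without α f)

  without-head : ∀ a γ f → without γ ((a , γ) ∷ f) ≡ without γ f
  without-head a γ f with γ ≟c γ
  ... | yes _   = ≡.refl
  ... | no γ≢γ  = ⊥-elim (γ≢γ ≡.refl)

  linear-≅[] : ∀ H f → f ≅ [] → linear H f ≈ 0#
  linear-≅[] H f f≅[] = bounded (length f) f ℕP.≤-refl (coeff≈ f≅[])
    where
    -- without γ f is shorter than (a , γ) ∷ f but not a subterm of it, hence the length bound.
    bounded : ∀ n f → length f ℕ.≤ n → f ≋ [] → linear H f ≈ 0#
    bounded n       []            _           _    = refl
    bounded (suc n) ((a , γ) ∷ f) (ℕ.s≤s f≤n) f≋[] = begin⟨ setoid ⟩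
      linear H ((a , γ) ∷ f)                                     ≈⟨ linear-without H γ ((a , γ) ∷ f) ⟩
      coeff ((a , γ) ∷ f) γ * H γ + linear H (without γ ((a , γ) ∷ f))
        ≈⟨ +-cong (trans (*-congʳ (f≋[] γ)) (zeroˡ (H γ))) (≡.subst (λ g → linear H g ≈ 0#) (≡.sym (without-head a γ f))
             (bounded n (without γ f) (ℕP.≤-trans (length-without γ f) f≤n) rest≋[])) ⟩
      0# + 0#                                                    ≈⟨ +-identityˡ 0# ⟩
      0#                                                         ∎
      where
      rest≋[] : without γ f ≋ []
      rest≋[] β with β ≟c γ
      ... | yes ≡.refl = coeff-without-≡ γ f
      ... | no β≢γ     = trans (coeff-without-≢ γ f β≢γ)
        (trans (sym (+-identityˡ _)) (trans (+-congʳ (sym (if-does-≢ a (λ γ≡β → β≢γ (≡.sym γ≡β))))) (f≋[] β)))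

  linear-resp-≅ : ∀ H {f g} → f ≅ g → linear H f ≈ linear H g
  linear-resp-≅ H {f} {g} f≅g = begin⟨ setoid ⟩
    linear H f                                         ≈⟨ +-identityʳ _ ⟨
    linear H f + 0#                                    ≈⟨ +-congˡ (-‿inverseˡ (linear H g)) ⟨
    linear H f + (- linear H g + linear H g)           ≈⟨ +-assoc _ _ _ ⟨
    linear H f + - linear H g + linear H g             ≈⟨ +-congʳ difference≈0 ⟩
    0# + linear H g                                    ≈⟨ +-identityˡ _ ⟩
    linear H g                                         ∎
    where
    difference≅[] : (f ++ scale (- 1#) g) ≅ []
    difference≅[] = mk≅ λ β → begin⟨ setoid ⟩
      coeff (f ++ scale (- 1#) g) β                    ≈⟨ coeff-++ f (scale (- 1#) g) β ⟩
      coeff f β + coeff (scale (- 1#) g) β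
        ≈⟨ +-cong (coeff≈ f≅g β) (trans (coeff-scale (- 1#) g β) (R.-1*x≈-x _)) ⟩
      coeff g β + - coeff g β                          ≈⟨ -‿inverseʳ _ ⟩
      0#                                               ∎
    difference≈0 : linear H f + - linear H g ≈ 0#
    difference≈0 = begin⟨ setoid ⟩
      linear H f + - linear H g
        ≈⟨ +-congˡ (trans (sym (R.-1*x≈-x _)) (sym (linear-scale H (- 1#) g))) ⟩
      linear H f + linear H (scale (- 1#) g)           ≈⟨ linear-++ H f (scale (- 1#) g) ⟨
      linear H (f ++ scale (- 1#) g)                   ≈⟨ linear-≅[] H _ difference≅[] ⟩
      0#                                               ∎

  -- The contribution of the term (a , α) to a product: ((a , α) ∷ f) ⊛ g reduces to termMul a α g ++ f ⊛ g.
  termMul : Carrier → Composition → QSym → QSym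
  termMul a α g = concatMap (λ { (b , β) → map (λ γ → (a * b , γ)) (qshuffle α β) }) g

  map-term-scale : ∀ {k b d} Q → k * b ≈ d → map (λ γ → (d , γ)) Q ≐ scale k (map (λ γ → (b , γ)) Q)
  map-term-scale []      kb≈d = []
  map-term-scale (γ ∷ Q) kb≈d = (sym kb≈d , ≡.refl) ∷ map-term-scale Q kb≈d

  termMul-scale : ∀ a α g → termMul a α g ≐ scale a (termMul 1# α g)
  termMul-scale a α []            = []
  termMul-scale a α ((b , β) ∷ g) =
    ≡.subst (termMul a α ((b , β) ∷ g) ≐_) (≡.sym (map-++ _ (map (λ γ → (1# * b , γ)) (qshuffle α β)) (termMul 1# α g)))
      (Pointwise.++⁺ (map-term-scale (qshuffle α β) (*-congˡ (*-identityˡ b))) (termMul-scale a α g))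

  coeff-⊛ : ∀ f g β → coeff (f ⊛ g) β ≈ linear (λ α → coeff (termMul 1# α g) β) f
  coeff-⊛ []            g β = refl
  coeff-⊛ ((a , α) ∷ f) g β = begin⟨ setoid ⟩
    coeff (termMul a α g ++ (f ⊛ g)) β                   ≈⟨ coeff-++ (termMul a α g) (f ⊛ g) β ⟩
    coeff (termMul a α g) β + coeff (f ⊛ g) β
      ≈⟨ +-cong (trans (≐⇒≋ (termMul-scale a α g) β) (coeff-scale a (termMul 1# α g) β)) (coeff-⊛ f g β) ⟩
    a * coeff (termMul 1# α g) β + linear (λ α → coeff (termMul 1# α g) β) f ∎

  coeff-termMul : ∀ α g β →
    coeff (termMul 1# α g) β ≈ linear (λ α′ → coeff (map (λ γ → (1# , γ)) (qshuffle α α′)) β) g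
  coeff-termMul α []             β = refl
  coeff-termMul α ((b , α′) ∷ g) β =
    trans (coeff-++ (map (λ γ → (1# * b , γ)) (qshuffle α α′)) (termMul 1# α g) β)
      (+-cong (trans (≐⇒≋ (map-term-scale (qshuffle α α′) (trans (*-identityʳ b) (sym (*-identityˡ b)))) β)
                     (coeff-scale b (map (λ γ → (1# , γ)) (qshuffle α α′)) β))
              (coeff-termMul α g β))

  ⊛-congˡ : ∀ {f f′} g → f ≅ f′ → (f ⊛ g) ≅ (f′ ⊛ g)
  ⊛-congˡ {f} {f′} g f≅f′ = mk≅ λ β →
    trans (coeff-⊛ f g β) (trans (linear-resp-≅ _ f≅f′) (sym (coeff-⊛ f′ g β)))

  ⊛-congʳ : ∀ f {g g′} → g ≅ g′ → (f ⊛ g) ≅ (f ⊛ g′)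
  ⊛-congʳ f {g} {g′} g≅g′ = mk≅ λ β →
    trans (coeff-⊛ f g β) (trans (linear-congˡ f (λ α →
      trans (coeff-termMul α g β) (trans (linear-resp-≅ _ g≅g′) (sym (coeff-termMul α g′ β)))))
      (sym (coeff-⊛ f g′ β)))

  termMul-++ : ∀ a α g g′ → termMul a α (g ++ g′) ≡ termMul a α g ++ termMul a α g′
  termMul-++ a α []            g′ = ≡.refl
  termMul-++ a α ((b , β) ∷ g) g′ =
    ≡.trans (≡.cong (map (λ γ → (a * b , γ)) (qshuffle α β) ++_) (termMul-++ a α g g′))
            (≡.sym (++-assoc (map (λ γ → (a * b , γ)) (qshuffle α β)) _ _))

  ⊛-distribˡ-++ : ∀ f g g′ → (f ⊛ (g ++ g′)) ≅ ((f ⊛ g) ++ (f ⊛ g′))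
  ⊛-distribˡ-++ f g g′ = mk≅ λ β → begin⟨ setoid ⟩
    coeff (f ⊛ (g ++ g′)) β                                     ≈⟨ coeff-⊛ f (g ++ g′) β ⟩
    linear (λ α → coeff (termMul 1# α (g ++ g′)) β) f
      ≈⟨ linear-congˡ f (λ α → trans (reflexive (≡.cong (λ h → coeff h β) (termMul-++ 1# α g g′)))
                                       (coeff-++ (termMul 1# α g) (termMul 1# α g′) β)) ⟩
    linear (λ α → coeff (termMul 1# α g) β + coeff (termMul 1# α g′) β) f ≈⟨ linear-+ _ _ f ⟩
    linear (λ α → coeff (termMul 1# α g) β) f + linear (λ α → coeff (termMul 1# α g′) β) f
      ≈⟨ +-cong (coeff-⊛ f g β) (coeff-⊛ f g′ β) ⟨
    coeff (f ⊛ g) β + coeff (f ⊛ g′) β                          ≈⟨ coeff-++ (f ⊛ g) (f ⊛ g′) β ⟨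
    coeff ((f ⊛ g) ++ (f ⊛ g′)) β                               ∎

  ⊛-zeroʳ : ∀ f → (f ⊛ []) ≡ []
  ⊛-zeroʳ []            = ≡.refl
  ⊛-zeroʳ ((a , α) ∷ f) = ⊛-zeroʳ f

  ⊛-concat : ∀ {X : Set} f (G : X → QSym) xs → (f ⊛ concat (map G xs)) ≅ concat (map (λ x → f ⊛ G x) xs)
  ⊛-concat f G []       = ≅-reflexive (⊛-zeroʳ f)
  ⊛-concat f G (x ∷ xs) = ≅-trans (⊛-distribˡ-++ f (G x) (concat (map G xs))) (++-cong ≅-refl (⊛-concat f G xs))

  termMul-scaleʳ : ∀ a b x α g → termMul (a * x) α (scale b g) ≐ scale (a * b) (termMul x α g)
  termMul-scaleʳ a b x α []            = []
  termMul-scaleʳ a b x α ((y , β) ∷ g) =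
    ≡.subst (termMul (a * x) α (scale b ((y , β) ∷ g)) ≐_)
      (≡.sym (map-++ _ (map (λ γ → (x * y , γ)) (qshuffle α β)) (termMul x α g)))
      (Pointwise.++⁺ (map-term-scale (qshuffle α β) (sym (*CS.interchange a x b y))) (termMul-scaleʳ a b x α g))

  ⊛-scale : ∀ a b f g → (scale a f ⊛ scale b g) ≐ scale (a * b) (f ⊛ g)
  ⊛-scale a b []            g = []
  ⊛-scale a b ((x , α) ∷ f) g =
    ≡.subst ((scale a ((x , α) ∷ f) ⊛ scale b g) ≐_) (≡.sym (map-++ _ (termMul x α g) (f ⊛ g)))
      (Pointwise.++⁺ (termMul-scaleʳ a b x α g) (⊛-scale a b f g))

  coeff²-++ : ∀ s t β γ → coeff² (s ++ t) β γ ≈ coeff² s β γ + coeff² t β γ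
  coeff²-++ []                 t β γ = sym (+-identityˡ _)
  coeff²-++ ((a , α , α′) ∷ s) t β γ = trans (+-congˡ (coeff²-++ s t β γ)) (sym (+-assoc _ _ _))

  coeff²-scale : ∀ k t β γ → coeff² (scale² k t) β γ ≈ k * coeff² t β γ
  coeff²-scale k []                 β γ = sym (zeroʳ k)
  coeff²-scale k ((a , α , α′) ∷ t) β γ with does (α ≟c β) | does (α′ ≟c γ)
  ... | true  | true  = trans (+-congˡ (coeff²-scale k t β γ)) (sym (distribˡ k a _))
  ... | true  | false = trans (+-cong (sym (zeroʳ k)) (coeff²-scale k t β γ)) (sym (distribˡ k 0# _))
  ... | false | _     = trans (+-cong (sym (zeroʳ k)) (coeff²-scale k t β γ)) (sym (distribˡ k 0# _))

  ≐⇒≋² : ∀ {s t} → s ≐ t → s ≋² t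
  ≐⇒≋² []                                            β γ = refl
  ≐⇒≋² (_∷_ {x = a , α , α′} (a≈b , ≡.refl) s≐t) β γ with does (α ≟c β) | does (α′ ≟c γ)
  ... | true  | true  = +-cong a≈b (≐⇒≋² s≐t β γ)
  ... | true  | false = +-congˡ (≐⇒≋² s≐t β γ)
  ... | false | _     = +-congˡ (≐⇒≋² s≐t β γ)

  infix 4 _≅²_
  record _≅²_ (s t : QSym²) : Set ℓ where
    constructor mk≅²
    field coeff²≈ : s ≋² t
  open _≅²_ public

  ≅²-setoid : Setoid c ℓ
  ≅²-setoid = record
    { Carrier       = QSym²
    ; _≈_           = _≅²_
    ; isEquivalence = record
      { refl  = mk≅² (λ β γ → refl)
      ; sym   = λ s≅t → mk≅² (λ β γ → sym (coeff²≈ s≅t β γ))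
      ; trans = λ s≅t t≅u → mk≅² (λ β γ → trans (coeff²≈ s≅t β γ) (coeff²≈ t≅u β γ))
      }
    }

  open Setoid ≅²-setoid public using () renaming (refl to ≅²-refl; trans to ≅²-trans; reflexive to ≅²-reflexive)

  ≐⇒≅² : ∀ {s t} → s ≐ t → s ≅² t
  ≐⇒≅² s≐t = mk≅² (≐⇒≋² s≐t)

  ++-cong² : ∀ {s s′ t t′} → s ≅² s′ → t ≅² t′ → (s ++ t) ≅² (s′ ++ t′)
  ++-cong² {s} {s′} {t} {t′} s≅s′ t≅t′ = mk≅² λ β γ →
    trans (coeff²-++ s t β γ) (trans (+-cong (coeff²≈ s≅s′ β γ) (coeff²≈ t≅t′ β γ)) (sym (coeff²-++ s′ t′ β γ)))

  scale²-cong : ∀ {k k′ s s′} → k ≈ k′ → s ≅² s′ → scale² k s ≅² scale² k′ s′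
  scale²-cong {k} {k′} {s} {s′} k≈k′ s≅s′ = mk≅² λ β γ →
    trans (coeff²-scale k s β γ) (trans (*-cong k≈k′ (coeff²≈ s≅s′ β γ)) (sym (coeff²-scale k′ s′ β γ)))

  scale²-scale² : ∀ {k k′ k″} → k * k′ ≈ k″ → ∀ t → scale² k (scale² k′ t) ≐ scale² k″ t
  scale²-scale² kk′≈k″ []            = []
  scale²-scale² kk′≈k″ ((a , αα) ∷ t) =
    (trans (sym (*-assoc _ _ a)) (*-congʳ kk′≈k″) , ≡.refl) ∷ scale²-scale² kk′≈k″ t

  scale²-concat : ∀ {X : Set} k (G : X → QSym²) xs → scale² k (concat (map G xs)) ≡ concat (map (scale² k ∘ G) xs)
  scale²-concat k G xs = ≡.trans (≡.sym (concat-map (map G xs))) (≡.cong concat (≡.sym (map-∘ xs)))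

  concat-map-cong² : ∀ {X : Set} {G H : X → QSym²} xs → (∀ {x} → x ∈ xs → G x ≅² H x) →
                     concat (map G xs) ≅² concat (map H xs)
  concat-map-cong² []       G≅H = ≅²-refl
  concat-map-cong² (x ∷ xs) G≅H = ++-cong² (G≅H (here ≡.refl)) (concat-map-cong² xs (G≅H ∘ there))

  Δ-term : Carrier → Composition → QSym²
  Δ-term a γ = map (λ { (x , y) → (a , x , y) }) (deconc γ)

  Δ-scale : ∀ k f → Δ (scale k f) ≡ scale² k (Δ f)
  Δ-scale k []            = ≡.refl
  Δ-scale k ((a , γ) ∷ f) =
    ≡.trans (≡.cong₂ _++_ (≡.sym (scale²-Δ-term (deconc γ))) (Δ-scale k f))
            (≡.sym (map-++ _ (Δ-term a γ) (Δ f)))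
    where
    scale²-Δ-term : ∀ D → scale² k (map (λ { (x , y) → (a , x , y) }) D) ≡ map (λ { (x , y) → (k * a , x , y) }) D
    scale²-Δ-term []      = ≡.refl
    scale²-Δ-term (_ ∷ D) = ≡.cong (_ ∷_) (scale²-Δ-term D)

  Δ-≐ : ∀ {f g} → f ≐ g → Δ f ≐ Δ g
  Δ-≐ []                                          = []
  Δ-≐ (_∷_ {x = a , γ} {y = b , _} (a≈b , ≡.refl) f≐g) = Pointwise.++⁺ (Δ-term-≐ (deconc γ)) (Δ-≐ f≐g)
    where
    Δ-term-≐ : ∀ D → map (λ { (x , y) → (a , x , y) }) D ≐ map (λ { (x , y) → (b , x , y) }) D
    Δ-term-≐ []      = []
    Δ-term-≐ (_ ∷ D) = (a≈b , ≡.refl) ∷ Δ-term-≐ D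

  ⊗-scale : ∀ a b f g → (scale a f ⊗ scale b g) ≐ scale² (a * b) (f ⊗ g)
  ⊗-scale a b []            g = []
  ⊗-scale a b ((x , α) ∷ f) g =
    ≡.subst ((scale a ((x , α) ∷ f) ⊗ scale b g) ≐_) (≡.sym (map-++ _ (row g) (f ⊗ g)))
      (Pointwise.++⁺ (row-scale g) (⊗-scale a b f g))
    where
    row : QSym → QSym²
    row g = map (λ { (y , β) → (x * y , α , β) }) g
    row-scale : ∀ g → map (λ { (y , β) → (a * x * y , α , β) }) (scale b g) ≐ scale² (a * b) (row g)
    row-scale []            = []
    row-scale ((y , β) ∷ g) = (*CS.interchange a x b y , ≡.refl) ∷ row-scale g

  if-*-if : ∀ p q x y → (if p then (if q then x * y else 0#) else 0#) ≈ (if p then x else 0#) * (if q then y else 0#)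
  if-*-if true  true  x y = refl
  if-*-if true  false x y = sym (zeroʳ x)
  if-*-if false q     x y = sym (zeroˡ _)

  coeff²-⊗ : ∀ f g β γ → coeff² (f ⊗ g) β γ ≈ coeff f β * coeff g γ
  coeff²-⊗ []            g β γ = sym (zeroˡ _)
  coeff²-⊗ ((a , α) ∷ f) g β γ = begin⟨ setoid ⟩
    coeff² (row g ++ (f ⊗ g)) β γ                                   ≈⟨ coeff²-++ (row g) (f ⊗ g) β γ ⟩
    coeff² (row g) β γ + coeff² (f ⊗ g) β γ                         ≈⟨ +-cong (coeff²-row g) (coeff²-⊗ f g β γ) ⟩
    (if does (α ≟c β) then a else 0#) * coeff g γ + coeff f β * coeff g γ ≈⟨ distribʳ _ _ _ ⟨
    ((if does (α ≟c β) then a else 0#) + coeff f β) * coeff g γ     ∎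
    where
    row : QSym → QSym²
    row g = map (λ { (b , α′) → (a * b , α , α′) }) g
    coeff²-row : ∀ g → coeff² (row g) β γ ≈ (if does (α ≟c β) then a else 0#) * coeff g γ
    coeff²-row []             = sym (zeroʳ _)
    coeff²-row ((b , α′) ∷ g) =
      trans (+-cong (if-*-if (does (α ≟c β)) (does (α′ ≟c γ)) a b) (coeff²-row g)) (sym (distribˡ _ _ _))

  coeff²-Δ-[] : ∀ f → coeff² (Δ f) [] [] ≈ coeff f []
  coeff²-Δ-[] []            = refl
  coeff²-Δ-[] ((a , γ) ∷ f) =
    trans (coeff²-++ (Δ-term a γ) (Δ f) [] []) (+-cong (coeff²-Δ-term γ) (coeff²-Δ-[] f))
    where
    coeff²-Δ-term : ∀ γ → coeff² (Δ-term a γ) [] [] ≈ (if does (γ ≟c []) then a else 0#)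
    coeff²-Δ-term []      = +-identityʳ a
    coeff²-Δ-term (b ∷ γ) = trans (+-identityˡ _) (nonempty-left (deconc γ))
      where
      nonempty-left : ∀ D → coeff² (map (λ { (x , y) → (a , x , y) }) (map (λ { (x , y) → (b ∷ x , y) }) D)) [] [] ≈ 0#
      nonempty-left []      = refl
      nonempty-left (_ ∷ D) = trans (+-identityˡ _) (nonempty-left D)

  sumQ-++ : ∀ (Y : Composition → QSym) S T → sumQ (map Y (S ++ T)) ≡ sumQ (map Y S) ++ sumQ (map Y T)
  sumQ-++ Y S T = ≡.trans (≡.cong concat (map-++ Y S T)) (≡.sym (concat-++ (map Y S) (map Y T)))

  sumQ-↭ : ∀ (Y : Composition → QSym) {S T} → S ↭ T → sumQ (map Y S) ≅ sumQ (map Y T)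
  sumQ-↭ Y ↭.refl          = ≅-refl
  sumQ-↭ Y (↭.prep s S↭T)  = ++-cong ≅-refl (sumQ-↭ Y S↭T)
  sumQ-↭ Y {s ∷ t ∷ S} {.t ∷ .s ∷ T} (↭.swap s t S↭T) = begin⟨ ≅-setoid ⟩
    Y s ++ (Y t ++ sumQ (map Y S))   ≈⟨ ≅-reflexive (≡.sym (++-assoc (Y s) (Y t) _)) ⟩
    (Y s ++ Y t) ++ sumQ (map Y S)   ≈⟨ ++-cong (++-comm-≅ (Y s) (Y t)) (sumQ-↭ Y S↭T) ⟩
    (Y t ++ Y s) ++ sumQ (map Y T)   ≈⟨ ≅-reflexive (++-assoc (Y t) (Y s) _) ⟩
    Y t ++ (Y s ++ sumQ (map Y T))   ∎
  sumQ-↭ Y (↭.trans S↭T T↭U) = ≅-trans (sumQ-↭ Y S↭T) (sumQ-↭ Y T↭U)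

  sumQ-replicate : ∀ (Y : Composition → QSym) m L →
                   sumQ (map Y (concat (replicate m L))) ≅ scale (fromℕ m) (sumQ (map Y L))
  sumQ-replicate Y zero    L = mk≅ λ β → sym (trans (coeff-scale 0# (sumQ (map Y L)) β) (zeroˡ _))
  sumQ-replicate Y (suc m) L = begin⟨ ≅-setoid ⟩
    sumQ (map Y (L ++ concat (replicate m L)))           ≈⟨ ≅-reflexive (sumQ-++ Y L (concat (replicate m L))) ⟩
    Σ ++ sumQ (map Y (concat (replicate m L)))           ≈⟨ ++-cong ≅-refl (sumQ-replicate Y m L) ⟩
    Σ ++ scale (fromℕ m) Σ                               ≈⟨ mk≅ (λ β → begin⟨ setoid ⟩
      coeff (Σ ++ scale (fromℕ m) Σ) β                   ≈⟨ coeff-++ Σ (scale (fromℕ m) Σ) β ⟩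
      coeff Σ β + coeff (scale (fromℕ m) Σ) β            ≈⟨ +-cong (sym (*-identityˡ _)) (coeff-scale (fromℕ m) Σ β) ⟩
      1# * coeff Σ β + fromℕ m * coeff Σ β               ≈⟨ distribʳ _ _ _ ⟨
      fromℕ (suc m) * coeff Σ β                          ≈⟨ coeff-scale (fromℕ (suc m)) Σ β ⟨
      coeff (scale (fromℕ (suc m)) Σ) β                  ∎) ⟩
    scale (fromℕ (suc m)) Σ                              ∎
    where
    Σ = sumQ (map Y L)

  sumQ-concatMap : ∀ (Y : Composition → QSym) (G : Composition → List Composition) S →
                   concat (map (λ γ → sumQ (map Y (G γ))) S) ≡ sumQ (map Y (concatMap G S))
  sumQ-concatMap Y G []      = ≡.refl
  sumQ-concatMap Y G (γ ∷ S) = ≡.trans (≡.cong (sumQ (map Y (G γ)) ++_) (sumQ-concatMap Y G S))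
                                       (≡.sym (sumQ-++ Y (G γ) (concatMap G S)))

module Bases {c ℓ} (F : Field c ℓ) where
  open Field F
  open QSymOver F
  open FieldLemmas F
  open FormalSums F
  open import Relation.Binary.Reasoning.MultiSetoid

  lincomb-rescale : ∀ P (s : Composition → Carrier) L k →
                    lincomb (λ α → scale (s α) (P α)) L k ≐ lincomb P L (λ α → k α * s α)
  lincomb-rescale P s []      k = []
  lincomb-rescale P s (α ∷ L) k = Pointwise.++⁺ (scale-scale refl (P α)) (lincomb-rescale P s L k)

  lincomb-congᵗ : ∀ P L {k k′} → (∀ α → k α ≈ k′ α) → lincomb P L k ≐ lincomb P L k′
  lincomb-congᵗ P []      k≈k′ = []
  lincomb-congᵗ P (α ∷ L) k≈k′ = Pointwise.++⁺ (scale-congᵗ (k≈k′ α) (P α)) (lincomb-congᵗ P L k≈k′)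

  IsGradedBasis-rescale : ∀ {P} (s : Composition → Carrier) → (∀ α → ¬ (s α ≈ 0#)) →
                          IsGradedBasis P → IsGradedBasis (λ α → scale (s α) (P α))
  IsGradedBasis-rescale {P} s s≉0 basis = record
    { homogeneous = λ α β size≢ →
        trans (coeff-scale (s α) (P α) β) (trans (*-congˡ (homogeneous α β size≢)) (zeroʳ (s α)))
    ; independent = λ L k unique Σ≋[] α α∈L → x*y≈0⇒x≈0 (s≉0 α)
        (independent L (λ α → k α * s α) unique (λ β → trans (sym (≐⇒≋ (lincomb-rescale P s L k) β)) (Σ≋[] β)) α α∈L)
    ; spanning = λ f → let (L , k , f≋Σ) = spanning f in
        L , (λ α → k α * s α ⁻¹) , λ β → trans (f≋Σ β) (sym (≐⇒≋ (≐-trans (lincomb-rescale P s L _)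
          (lincomb-congᵗ P L (λ α → trans (*-assoc (k α) _ _)
            (trans (*-congˡ (⁻¹-inverseˡ (s≉0 α))) (*-identityʳ (k α)))))) β))
    }
    where open IsGradedBasis basis

  size≡0⇒[] : ∀ β → size β ≡ 0 → β ≡ []
  size≡0⇒[] []      _ = ≡.refl
  size≡0⇒[] (b ∷ β) ()

  module _ {X} (shuffleBasis : IsShuffleBasis X) where
    open IsShuffleBasis shuffleBasis
    open IsGradedBasis gradedBasis

    private
      c₀ : Carrier
      c₀ = coeff (X []) []

      coeff-X[]-≢[] : ∀ {β} → β ≢ [] → coeff (X []) β ≈ 0#
      coeff-X[]-≢[] {β} β≢[] = homogeneous [] β (λ size≡ → β≢[] (size≡0⇒[] β size≡))

      c₀-idempotent : c₀ ≈ c₀ * c₀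
      c₀-idempotent = begin⟨ setoid ⟩
        c₀                                    ≈⟨ coeff²-Δ-[] (X []) ⟨
        coeff² (Δ (X [])) [] []               ≈⟨ coproduct-rule [] [] [] ⟩
        coeff² ((X [] ⊗ X []) ++ []) [] []    ≈⟨ trans (coeff²-++ (X [] ⊗ X []) [] [] []) (+-identityʳ _) ⟩
        coeff² (X [] ⊗ X []) [] []            ≈⟨ coeff²-⊗ (X []) (X []) [] [] ⟩
        c₀ * c₀                               ∎

      c₀≉0 : ¬ (c₀ ≈ 0#)
      c₀≉0 c₀≈0 = 0≉1 (sym (independent [ [] ] (λ _ → 1#) ([] ∷ []) X[]≋[] [] (here ≡.refl)))
        where
        X[]≋[] : lincomb X [ [] ] (λ _ → 1#) ≋ []
        X[]≋[] β = trans (coeff-++ (scale 1# (X [])) [] β) (trans (+-identityʳ _)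
          (trans (≐⇒≋ (scale-1 (X [])) β) (by-cases (β ≟c []))))
          where
          by-cases : Dec (β ≡ []) → coeff (X []) β ≈ 0#
          by-cases (yes ≡.refl) = c₀≈0
          by-cases (no β≢[])    = coeff-X[]-≢[] β≢[]

    shuffleBasis-unit : X [] ≅ M []
    shuffleBasis-unit = mk≅ λ β → by-cases β (β ≟c [])
      where
      c₀≈1 : c₀ ≈ 1#
      c₀≈1 = begin⟨ setoid ⟩
        c₀                   ≈⟨ ⁻¹-cancelˡ c₀≉0 c₀ ⟨
        c₀ ⁻¹ * (c₀ * c₀)    ≈⟨ *-congˡ c₀-idempotent ⟨
        c₀ ⁻¹ * c₀           ≈⟨ ⁻¹-inverseˡ c₀≉0 ⟩
        1#                   ∎
      by-cases : ∀ β → Dec (β ≡ []) → coeff (X []) β ≈ coeff (M []) β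
      by-cases β (yes ≡.refl) = trans c₀≈1 (sym (+-identityʳ 1#))
      by-cases β (no β≢[])    = trans (coeff-X[]-≢[] β≢[])
        (sym (trans (+-identityʳ _) (if-does-≢ 1# (λ []≡β → β≢[] (≡.sym []≡β)))))

    p≅sumQ-shuffleSingletons : (∀ n → X [ n ] ≋ M [ n ]) → ∀ λ′ → p λ′ ≅ sumQ (map X (shuffleSingletons λ′))
    p≅sumQ-shuffleSingletons normalized []       = begin⟨ ≅-setoid ⟩
      M []          ≈⟨ shuffleBasis-unit ⟨
      X []          ≈⟨ ≅-reflexive (++-identityʳ (X [])) ⟨
      X [] ++ []    ∎
    p≅sumQ-shuffleSingletons normalized (n ∷ λ′) = begin⟨ ≅-setoid ⟩
      M [ n ] ⊛ p λ′
        ≈⟨ ⊛-congˡ {M [ n ]} {X [ n ]} (p λ′) (mk≅ λ β → sym (normalized n β)) ⟩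
      X [ n ] ⊛ p λ′                                   ≈⟨ ⊛-congʳ (X [ n ]) (p≅sumQ-shuffleSingletons normalized λ′) ⟩
      X [ n ] ⊛ sumQ (map X S)                         ≈⟨ ⊛-concat (X [ n ]) X S ⟩
      concat (map (λ δ → X [ n ] ⊛ X δ) S)             ≈⟨ concat-map-cong S (λ {δ} _ → mk≅ (product-rule [ n ] δ)) ⟩
      concat (map (λ δ → sumQ (map X (insertions n δ))) S) ≈⟨ ≅-reflexive (sumQ-concatMap X (insertions n) S) ⟩
      sumQ (map X (shuffleSingletons (n ∷ λ′)))        ∎
      where S = shuffleSingletons λ′

module Rescaling {c ℓ} (F : Field c ℓ) (char0 : CharZero F) where
  open Field F
  open QSymOver F
  open FieldLemmas F
  open FormalSums F
  open Bases F
  open import Relation.Binary.Reasoning.MultiSetoid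

  autᶠ : Composition → Carrier
  autᶠ α = fromℕ (aut α)

  autᶠ-≉0 : ∀ α → ¬ (autᶠ α ≈ 0#)
  autᶠ-≉0 α = fromℕ-≉0 char0 (aut α) {{aut-nonZero α}}

  private
    prodParts-≉0 : ∀ γ → ¬ (fromℕ (prodParts γ) ≈ 0#)
    prodParts-≉0 γ = fromℕ-≉0 char0 (prodParts γ) {{prodParts-nonZero γ}}

    autᶠ*autᶠ-≉0 : ∀ α β → ¬ (fromℕ (aut α ℕ.* aut β) ≈ 0#)
    autᶠ*autᶠ-≉0 α β ≈0 = *-≉0 (autᶠ-≉0 α) (autᶠ-≉0 β) (trans (sym (fromℕ-* (aut α) (aut β))) ≈0)

  z-ratio : ∀ α β → (z α ℕ.* z β) ÷ z (α ++ β) ≈ autᶠ α * autᶠ β * autᶠ (α ++ β) ⁻¹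
  z-ratio α β = begin⟨ setoid ⟩
    (z α ℕ.* z β) ÷ z (α ++ β)
      ≈⟨ reflexive (≡.cong (_÷ z (α ++ β)) (z*z≡aut*aut*prodParts α β)) ⟩
    ((aut α ℕ.* aut β) ℕ.* prodParts (α ++ β)) ÷ (aut (α ++ β) ℕ.* prodParts (α ++ β))
      ≈⟨ ÷-cancelʳ (aut α ℕ.* aut β) (aut (α ++ β)) _ (autᶠ-≉0 (α ++ β)) (prodParts-≉0 (α ++ β)) ⟩
    (aut α ℕ.* aut β) ÷ aut (α ++ β)
      ≈⟨ *-congʳ (fromℕ-* (aut α) (aut β)) ⟩
    autᶠ α * autᶠ β * autᶠ (α ++ β) ⁻¹
      ∎

  z-ratio⁻¹ : ∀ α β {γ} → α ++ β ≡ γ → z γ ÷ (z α ℕ.* z β) ≈ autᶠ γ * (autᶠ α ⁻¹ * autᶠ β ⁻¹)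
  z-ratio⁻¹ α β ≡.refl = begin⟨ setoid ⟩
    z (α ++ β) ÷ (z α ℕ.* z β)
      ≈⟨ reflexive (≡.cong (z (α ++ β) ÷_) (z*z≡aut*aut*prodParts α β)) ⟩
    (aut (α ++ β) ℕ.* prodParts (α ++ β)) ÷ ((aut α ℕ.* aut β) ℕ.* prodParts (α ++ β))
      ≈⟨ ÷-cancelʳ (aut (α ++ β)) (aut α ℕ.* aut β) _ (autᶠ*autᶠ-≉0 α β) (prodParts-≉0 (α ++ β)) ⟩
    aut (α ++ β) ÷ (aut α ℕ.* aut β)
      ≈⟨ *-congˡ (⁻¹-cong (autᶠ*autᶠ-≉0 α β) (fromℕ-* (aut α) (aut β))) ⟩
    autᶠ (α ++ β) * (autᶠ α * autᶠ β) ⁻¹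
      ≈⟨ *-congˡ (⁻¹-distrib-* (autᶠ-≉0 α) (autᶠ-≉0 β)) ⟩
    autᶠ (α ++ β) * (autᶠ α ⁻¹ * autᶠ β ⁻¹)
      ∎

  module _ (P : Composition → QSym) where

    X : Composition → QSym
    X α = scale (autᶠ α ⁻¹) (P α)

    P≐autᶠ*X : ∀ α → P α ≐ scale (autᶠ α) (X α)
    P≐autᶠ*X α = ≐-sym (≐-trans (scale-scale (⁻¹-inverse (autᶠ α) (autᶠ-≉0 α)) (P α)) (scale-1 (P α)))

    sumQ-X-shuffle : ∀ α β → sumQ (map X (shuffle α β)) ≡ scale (autᶠ (α ++ β) ⁻¹) (sumQ (map P (shuffle α β)))
    sumQ-X-shuffle α β = ≡.trans
      (≡.cong concat (map-cong-local (All.tabulate λ γ∈ →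
        ≡.cong (λ n → scale (fromℕ n ⁻¹) (P _)) (aut-↭ (∈-shuffle⇒↭ α β γ∈)))))
      (≡.sym (scale-concat _ P (shuffle α β)))

    QPS-product⇒shuffle-product : ∀ α β →
      (P α ⊛ P β) ≋ scale ((z α ℕ.* z β) ÷ z (α ++ β)) (sumQ (map P (shuffle α β))) →
      (X α ⊛ X β) ≋ sumQ (map X (shuffle α β))
    QPS-product⇒shuffle-product α β product = coeff≈ (begin⟨ ≅-setoid ⟩
      X α ⊛ X β                                         ≈⟨ ≐⇒≅ (⊛-scale _ _ (P α) (P β)) ⟩
      scale (autᶠ α ⁻¹ * autᶠ β ⁻¹) (P α ⊛ P β)          ≈⟨ scale-cong refl (mk≅ product) ⟩
      scale (autᶠ α ⁻¹ * autᶠ β ⁻¹) (scale r ΣP)         ≈⟨ ≐⇒≅ (scale-scale refl ΣP) ⟩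
      scale (autᶠ α ⁻¹ * autᶠ β ⁻¹ * r) ΣP               ≈⟨ scale-cong ratio ≅-refl ⟩
      scale (autᶠ (α ++ β) ⁻¹) ΣP                       ≈⟨ ≅-reflexive (sumQ-X-shuffle α β) ⟨
      sumQ (map X (shuffle α β))                        ∎)
      where
      r = (z α ℕ.* z β) ÷ z (α ++ β)
      ΣP = sumQ (map P (shuffle α β))
      ratio : autᶠ α ⁻¹ * autᶠ β ⁻¹ * r ≈ autᶠ (α ++ β) ⁻¹
      ratio = trans (*-congˡ (z-ratio α β)) (⁻¹*⁻¹-cancelˡ (autᶠ-≉0 α) (autᶠ-≉0 β) _)

    shuffle-product⇒QPS-product : ∀ α β →
      (X α ⊛ X β) ≋ sumQ (map X (shuffle α β)) →
      (P α ⊛ P β) ≋ scale ((z α ℕ.* z β) ÷ z (α ++ β)) (sumQ (map P (shuffle α β)))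
    shuffle-product⇒QPS-product α β product = coeff≈ (begin⟨ ≅-setoid ⟩
      P α ⊛ P β                                         ≈⟨ ⊛-congˡ (P β) (≐⇒≅ (P≐autᶠ*X α)) ⟩
      scale (autᶠ α) (X α) ⊛ P β                        ≈⟨ ⊛-congʳ (scale (autᶠ α) (X α)) (≐⇒≅ (P≐autᶠ*X β)) ⟩
      scale (autᶠ α) (X α) ⊛ scale (autᶠ β) (X β)       ≈⟨ ≐⇒≅ (⊛-scale _ _ (X α) (X β)) ⟩
      scale (autᶠ α * autᶠ β) (X α ⊛ X β)               ≈⟨ scale-cong refl (mk≅ product) ⟩
      scale (autᶠ α * autᶠ β) (sumQ (map X (shuffle α β))) ≈⟨ ≅-reflexive (≡.cong (scale _) (sumQ-X-shuffle α β)) ⟩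
      scale (autᶠ α * autᶠ β) (scale (autᶠ (α ++ β) ⁻¹) ΣP) ≈⟨ ≐⇒≅ (scale-scale refl ΣP) ⟩
      scale (autᶠ α * autᶠ β * autᶠ (α ++ β) ⁻¹) ΣP     ≈⟨ scale-cong (z-ratio α β) ≅-refl ⟨
      scale ((z α ℕ.* z β) ÷ z (α ++ β)) ΣP             ∎)
      where ΣP = sumQ (map P (shuffle α β))

    QPS-coproduct⇒shuffle-coproduct : ∀ γ →
      Δ (P γ) ≋² concat (map (λ { (β , γ′) → scale² (z γ ÷ (z β ℕ.* z γ′)) (P β ⊗ P γ′) }) (deconc γ)) →
      Δ (X γ) ≋² concat (map (λ { (α , β) → X α ⊗ X β }) (deconc γ))
    QPS-coproduct⇒shuffle-coproduct γ coproduct = coeff²≈ (begin⟨ ≅²-setoid ⟩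
      Δ (X γ)                                    ≈⟨ ≅²-reflexive (Δ-scale _ (P γ)) ⟩
      scale² (autᶠ γ ⁻¹) (Δ (P γ))               ≈⟨ scale²-cong refl (mk≅² coproduct) ⟩
      scale² (autᶠ γ ⁻¹) (concat (map T D))      ≈⟨ ≅²-reflexive (scale²-concat _ T D) ⟩
      concat (map (scale² (autᶠ γ ⁻¹) ∘ T) D)    ≈⟨ concat-map-cong² D term ⟩
      concat (map T′ D)                          ∎)
      where
      D = deconc γ
      T T′ : Composition × Composition → QSym²
      T  = λ { (β , γ′) → scale² (z γ ÷ (z β ℕ.* z γ′)) (P β ⊗ P γ′) }
      T′ = λ { (α , β) → X α ⊗ X β }
      term : ∀ {αβ} → αβ ∈ D → scale² (autᶠ γ ⁻¹) (T αβ) ≅² T′ αβ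
      term {α , β} αβ∈D = ≐⇒≅² (≐-trans (scale²-scale² ratio (P α ⊗ P β)) (≐-sym (⊗-scale _ _ (P α) (P β))))
        where
        ratio : autᶠ γ ⁻¹ * (z γ ÷ (z α ℕ.* z β)) ≈ autᶠ α ⁻¹ * autᶠ β ⁻¹
        ratio = trans (*-congˡ (z-ratio⁻¹ α β (∈-deconc⇒++ γ αβ∈D))) (⁻¹-cancelˡ (autᶠ-≉0 γ) _)

    shuffle-coproduct⇒QPS-coproduct : ∀ γ →
      Δ (X γ) ≋² concat (map (λ { (α , β) → X α ⊗ X β }) (deconc γ)) →
      Δ (P γ) ≋² concat (map (λ { (β , γ′) → scale² (z γ ÷ (z β ℕ.* z γ′)) (P β ⊗ P γ′) }) (deconc γ))
    shuffle-coproduct⇒QPS-coproduct γ coproduct = coeff²≈ (begin⟨ ≅²-setoid ⟩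
      Δ (P γ)                                    ≈⟨ ≐⇒≅² (Δ-≐ (P≐autᶠ*X γ)) ⟩
      Δ (scale (autᶠ γ) (X γ))                   ≈⟨ ≅²-reflexive (Δ-scale _ (X γ)) ⟩
      scale² (autᶠ γ) (Δ (X γ))                  ≈⟨ scale²-cong refl (mk≅² coproduct) ⟩
      scale² (autᶠ γ) (concat (map T D))         ≈⟨ ≅²-reflexive (scale²-concat _ T D) ⟩
      concat (map (scale² (autᶠ γ) ∘ T) D)       ≈⟨ concat-map-cong² D term ⟩
      concat (map T′ D)                          ∎)
      where
      D = deconc γ
      T T′ : Composition × Composition → QSym²
      T  = λ { (α , β) → X α ⊗ X β }
      T′ = λ { (β , γ′) → scale² (z γ ÷ (z β ℕ.* z γ′)) (P β ⊗ P γ′) }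
      term : ∀ {αβ} → αβ ∈ D → scale² (autᶠ γ) (T αβ) ≅² T′ αβ
      term {α , β} αβ∈D = ≅²-trans (scale²-cong refl (≐⇒≅² (⊗-scale _ _ (P α) (P β))))
                                   (≐⇒≅² (scale²-scale² (sym (z-ratio⁻¹ α β (∈-deconc⇒++ γ αβ∈D))) (P α ⊗ P β)))

    power-sum⇒normalized :
      (∀ (λ′ : Composition) → IsPartition λ′ → ∀ L → Unique L → (∀ α → (α ∈ L) ⇔ (α ↭ λ′)) → sumQ (map P L) ≋ p λ′) →
      ∀ n → X [ n ] ≋ M [ n ]
    power-sum⇒normalized power-sum n = coeff≈ (begin⟨ ≅-setoid ⟩
      X [ n ]                 ≈⟨ scale-cong autᶠ[n]⁻¹≈1 ≅-refl ⟩
      scale 1# (P [ n ])      ≈⟨ ≐⇒≅ (scale-1 (P [ n ])) ⟩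
      P [ n ]                 ≈⟨ ≅-reflexive (++-identityʳ (P [ n ])) ⟨
      sumQ (map P [ [ n ] ])  ≈⟨ mk≅ (power-sum [ n ] [-] [ [ n ] ] ([] ∷ []) rearrangements-of-[n]) ⟩
      p [ n ]                 ≈⟨ ≐⇒≅ ((*-identityˡ 1# , ≡.refl) ∷ []) ⟩
      M [ n ]                 ∎)
      where
      autᶠ[n]⁻¹≈1 : autᶠ [ n ] ⁻¹ ≈ 1#
      autᶠ[n]⁻¹≈1 = sym (⁻¹-unique (autᶠ-≉0 [ n ])
        (trans (*-identityʳ _) (trans (reflexive (≡.cong fromℕ (aut-∷ n []))) (+-identityʳ 1#))))
      rearrangements-of-[n] : ∀ α → (α ∈ [ [ n ] ]) ⇔ (α ↭ [ n ])
      rearrangements-of-[n] α = mk⇔ (λ { (here ≡.refl) → ↭-refl }) (λ α↭[n] → here (↭-singleton-inv α↭[n]))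

    normalized⇒power-sum : IsShuffleBasis X → (∀ n → X [ n ] ≋ M [ n ]) →
      ∀ λ′ L → Unique L → (∀ α → (α ∈ L) ⇔ (α ↭ λ′)) → sumQ (map P L) ≋ p λ′
    normalized⇒power-sum shuffleBasis normalized λ′ L unique L≡rearrangements = coeff≈ (begin⟨ ≅-setoid ⟩
      sumQ (map P L)                                ≈⟨ concat-map-cong L P≅autᶠλ*X ⟩
      concat (map (scale (autᶠ λ′) ∘ X) L)           ≈⟨ ≅-reflexive (scale-concat _ X L) ⟨
      scale (autᶠ λ′) (sumQ (map X L))              ≈⟨ sumQ-replicate X (aut λ′) L ⟨
      sumQ (map X (concat (replicate (aut λ′) L)))  ≈⟨ sumQ-↭ X (shuffleSingletons-↭ λ′ unique L≡rearrangements) ⟨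
      sumQ (map X (shuffleSingletons λ′))           ≈⟨ p≅sumQ-shuffleSingletons shuffleBasis normalized λ′ ⟨
      p λ′                                          ∎)
      where
      P≅autᶠλ*X : ∀ {α} → α ∈ L → P α ≅ scale (autᶠ λ′) (X α)
      P≅autᶠλ*X {α} α∈L = ≐⇒≅ (≡.subst (λ n → P α ≐ scale (fromℕ n) (X α))
        (aut-↭ (Equivalence.to (L≡rearrangements α) α∈L)) (P≐autᶠ*X α))

proposition5p3 : ∀ {c ℓ} (F : Field c ℓ) → CharZero F →
    let open Field F
        open QSymOver F
    in (P : Composition → QSym) → IsGradedBasis P →
       IsQPSBasis P ⇔ IsNormalizedShuffleBasis (λ α → scale (fromℕ (aut α) ⁻¹) (P α))
proposition5p3 F char0 P basis = mk⇔ QPS⇒normalizedShuffle normalizedShuffle⇒QPS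
  where
  open QSymOver F
  open FieldLemmas F using (⁻¹-≉0)
  open Bases F using (IsGradedBasis-rescale)
  open Rescaling F char0

  QPS⇒normalizedShuffle : IsQPSBasis P → IsNormalizedShuffleBasis (X P)
  QPS⇒normalizedShuffle qps = record
    { shuffleBasis = record
      { gradedBasis    = IsGradedBasis-rescale _ (λ α → ⁻¹-≉0 (autᶠ-≉0 α)) basis
      ; product-rule   = λ α β → QPS-product⇒shuffle-product P α β (product-rule α β)
      ; coproduct-rule = λ γ → QPS-coproduct⇒shuffle-coproduct P γ (coproduct-rule γ)
      }
    ; normalized   = power-sum⇒normalized P power-sum-rule
    }
    where open IsQPSBasis qps

  normalizedShuffle⇒QPS : IsNormalizedShuffleBasis (X P) → IsQPSBasis P
  normalizedShuffle⇒QPS nsb = record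
    { gradedBasis    = basis
    ; product-rule   = λ α β → shuffle-product⇒QPS-product P α β (product-rule α β)
    ; coproduct-rule = λ γ → shuffle-coproduct⇒QPS-coproduct P γ (coproduct-rule γ)
    ; power-sum-rule = λ λ′ _ → normalized⇒power-sum P shuffleBasis normalized λ′
    }
    where
    open IsNormalizedShuffleBasis nsb
    open IsShuffleBasis shuffleBasis
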